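{- (1) Let $p_1,\dots,p_n$ be distinct points in $\mathbb{R}^2$, no three collinear, and color $\binom{[n]}{3}$ by $COL(i,j,k)=AREA(p_i,p_j,p_k)$. Then this coloring has no whomog set of size $6$. (2) Let $p_1,\dots,p_n$ be distinct points in $\mathbb{R}^3$, no three collinear, and color $\binom{[n]}{3}$ by $COL(i,j,k)=AREA(p_i,p_j,p_k)$. Then this coloring has no whomog set of size $13$.
   Context: $AREA(p,q,r)$ is the area of the triangle with vertices $p,q,r$. For a coloring $COL:\binom{[n]}{3}\to\mathbb{R}$ and $I\subsetneq\{1,2,3\}$, a set $V\subseteq[n]$ is $I$-whomog if for all $x_1<x_2<x_3$ and $y_1<y_2<y_3$ in $V$ with $x_i=y_i$ for all $i\in I$ we have $COL(x_1,x_2,x_3)=COL(y_1,y_2,y_3)$. $V$ is whomog if it is $I$-whomog for some proper subset $I$ of $\{1,2,3\}$ (including $I=\emptyset$). -}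

module Defs where

open import Level using (0ℓ)
open import Algebra.Bundles using (CommutativeRing)
open import Relation.Binary.Core using (Rel)
open import Relation.Binary.Structures using (IsTotalOrder)
open import Relation.Binary.PropositionalEquality using (_≡_; _≢_)
open import Relation.Nullary using (¬_)
open import Data.Nat using (ℕ)
open import Data.Fin using (Fin; zero; suc; _<_)
open import Data.Fin.Subset using (Subset; _∈_; ∣_∣)
open import Data.Product using (Σ; ∃; _×_; _,_)

-- The real numbers, axiomatised as a complete ordered field
-- (unique up to isomorphism), with an explicit square root function
-- (which exists in any complete ordered field).

record RealField : Set₁ where
  field
    commutativeRing : CommutativeRing 0ℓ 0ℓ
  open CommutativeRing commutativeRing public
  infix 4 _≤_
  field
    _⁻¹        : Carrier → Carrier
    ⁻¹-inverse : ∀ x → ¬ (x ≈ 0#) → x * (x ⁻¹) ≈ 1#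
    0≉1        : ¬ (0# ≈ 1#)
    _≤_        : Rel Carrier 0ℓ
    ≤-isTotalOrder : IsTotalOrder _≈_ _≤_
    +-mono-≤   : ∀ {x y} z → x ≤ y → x + z ≤ y + z
    *-nonneg   : ∀ {x y} → 0# ≤ x → 0# ≤ y → 0# ≤ x * y
    lub        : (P : Carrier → Set) → (∃ λ x → P x) →
                 (∃ λ b → ∀ x → P x → x ≤ b) →
                 ∃ λ s → (∀ x → P x → x ≤ s) ×
                         (∀ b → (∀ x → P x → x ≤ b) → s ≤ b)
    sqrt       : Carrier → Carrier
    sqrt-nonneg : ∀ x → 0# ≤ sqrt x
    sqrt-sq    : ∀ x → 0# ≤ x → sqrt x * sqrt x ≈ x

  _−_ : Carrier → Carrier → Carrier
  x − y = x + (- y)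

  half : Carrier
  half = (1# + 1#) ⁻¹

-- Whomogeneous sets for a coloring of triples of [n] (here [n] = Fin n,
-- triples are given in increasing order x₁ < x₂ < x₃).
-- I ⊆ {1,2,3} is a Subset 3 (index 0,1,2 for positions 1,2,3).

IWhomog : ∀ {a ℓ} {A : Set a} (_≈_ : Rel A ℓ) {n : ℕ} →
          (Fin n → Fin n → Fin n → A) → Subset 3 → Subset n → Set ℓ
IWhomog _≈_ {n} COL I V =
  ∀ (x₁ x₂ x₃ y₁ y₂ y₃ : Fin n) →
  x₁ ∈ V → x₂ ∈ V → x₃ ∈ V → y₁ ∈ V → y₂ ∈ V → y₃ ∈ V →
  x₁ < x₂ → x₂ < x₃ → y₁ < y₂ → y₂ < y₃ →
  (zero ∈ I → x₁ ≡ y₁) →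
  (suc zero ∈ I → x₂ ≡ y₂) →
  (suc (suc zero) ∈ I → x₃ ≡ y₃) →
  COL x₁ x₂ x₃ ≈ COL y₁ y₂ y₃

ProperSubset3 : Subset 3 → Set
ProperSubset3 I = ¬ (∀ i → i ∈ I)

Whomog : ∀ {a ℓ} {A : Set a} (_≈_ : Rel A ℓ) {n : ℕ} →
         (Fin n → Fin n → Fin n → A) → Subset n → Set ℓ
Whomog _≈_ COL V = Σ (Subset 3) λ I → ProperSubset3 I × IWhomog _≈_ COL I V

module Geometry (R : RealField) where
  open RealField R

  Point2 : Set
  Point2 = Carrier × Carrier

  Point3 : Set
  Point3 = Carrier × Carrier × Carrier

  _≈₂_ : Point2 → Point2 → Set
  (a , b) ≈₂ (c , d) = (a ≈ c) × (b ≈ d)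

  _≈₃_ : Point3 → Point3 → Set
  (a , b , c) ≈₃ (d , e , f) = (a ≈ d) × (b ≈ e) × (c ≈ f)

  det2 : Point2 → Point2 → Point2 → Carrier
  det2 (px , py) (qx , qy) (rx , ry) =
    ((qx − px) * (ry − py)) − ((qy − py) * (rx − px))

  cross3 : Point3 → Point3 → Point3 → Point3
  cross3 (px , py , pz) (qx , qy , qz) (rx , ry , rz) =
    let u₁ = qx − px ; u₂ = qy − py ; u₃ = qz − pz
        v₁ = rx − px ; v₂ = ry − py ; v₃ = rz − pz
    in ((u₂ * v₃) − (u₃ * v₂)) , ((u₃ * v₁) − (u₁ * v₃)) , ((u₁ * v₂) − (u₂ * v₁))

  normSq3 : Point3 → Carrier
  normSq3 (a , b , c) = (a * a) + ((b * b) + (c * c))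

  AREA2 : Point2 → Point2 → Point2 → Carrier
  AREA2 p q r = half * sqrt (det2 p q r * det2 p q r)

  AREA3 : Point3 → Point3 → Point3 → Carrier
  AREA3 p q r = half * sqrt (normSq3 (cross3 p q r))

  Collinear2 : Point2 → Point2 → Point2 → Set
  Collinear2 p q r = det2 p q r ≈ 0#

  Collinear3 : Point3 → Point3 → Point3 → Set
  Collinear3 p q r = cross3 p q r ≈₃ (0# , 0# , 0#)

  Distinct2 : ∀ {n} → (Fin n → Point2) → Set
  Distinct2 p = ∀ i j → i ≢ j → ¬ (p i ≈₂ p j)

  Distinct3 : ∀ {n} → (Fin n → Point3) → Set
  Distinct3 p = ∀ i j → i ≢ j → ¬ (p i ≈₃ p j)

  NoThreeCollinear2 : ∀ {n} → (Fin n → Point2) → Set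
  NoThreeCollinear2 p = ∀ i j k → i ≢ j → j ≢ k → i ≢ k →
                        ¬ Collinear2 (p i) (p j) (p k)

  NoThreeCollinear3 : ∀ {n} → (Fin n → Point3) → Set
  NoThreeCollinear3 p = ∀ i j k → i ≢ j → j ≢ k → i ≢ k →
                        ¬ Collinear3 (p i) (p j) (p k)

-- A whomogeneous set V has a position j outside I. Split an increasing enumeration of V into three
-- consecutive blocks, take the tips from the j-th block and a centre o and the spokes from the other
-- two: then all triangles (o, spoke, tip) with a fixed spoke have the same area.
--
-- In the plane, with vectors v, x, y from o, this says (v ∧ x)² = (v ∧ y)², so every spoke annihilates
-- x − y or x + y, and two of three pairwise independent spokes annihilate the same one: x ∥ y,
-- so o, x and y are collinear.
--
-- In space, tips x, y, z make the quadratic forms w ↦ ∣ w ⨯ y ∣² − ∣ w ⨯ x ∣² and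
-- w ↦ ∣ w ⨯ z ∣² − ∣ w ⨯ x ∣² vanish on five pairwise independent spokes. If three spokes are
-- coplanar, both forms vanish on their plane, and this forces y and z to be parallel to the mirror
-- image of x in that plane, hence to each other. Otherwise the spokes are five points in general position of the projective
-- plane, through which passes only one conic, so the two forms are proportional; evaluating them at
-- x, y and z shows that this is impossible.

module Submission where

open import Algebra.Bundles using (CommutativeRing; RawRing)
open import Data.Bool.Base using (true; false)
open import Data.Empty using (⊥; ⊥-elim)
open import Data.Fin using (#_)
open import Data.Fin.Base using (Fin; zero; suc; toℕ; _<_; _↑ˡ_; _↑ʳ_; inject≤)
open import Data.Fin.Properties
  using (toℕ-↑ˡ; toℕ-↑ʳ; toℕ<n; toℕ-inject≤; ↑ˡ-injective; ↑ʳ-injective; <-cmp; <⇒≢; ¬∀⟶∃¬)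
open import Data.Fin.Subset using (Subset; _∈_; ∣_∣)
open import Data.Fin.Subset.Properties using (_∈?_)
open import Data.Maybe.Base using (nothing)
open import Data.Nat.Base as ℕ using (ℕ; zero; suc; s≤s; z≤n)
import Data.Nat.Properties as ℕ
open import Data.Product.Base using (Σ; ∃; ∃₂; _×_; _,_; proj₁; proj₂)
open import Data.Product.Relation.Binary.Pointwise.NonDependent using (_×ₛ_)
open import Data.Sum.Base using (_⊎_; inj₁; inj₂; [_,_])
open import Data.Vec.Base using (Vec; []; _∷_; here; there)
open import Function.Base using (_∘_)
open import Level using (0ℓ; _⊔_)
open import Relation.Binary.Bundles using (Setoid)
open import Relation.Binary.Core using (Rel)
open import Relation.Binary.Definitions using (tri<; tri≈; tri>)
open import Relation.Binary.PropositionalEquality.Core as ≡ using (_≡_; _≢_; ≢-sym; cong; subst; subst₂)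
import Relation.Binary.Reasoning.Setoid
open import Relation.Binary.Structures using (IsTotalOrder)
open import Relation.Nullary.Decidable.Core using (yes; no; ¬¬-excluded-middle)
open import Relation.Nullary.Negation.Core using (¬_)
open import Tactic.RingSolver.Core.AlmostCommutativeRing using (fromCommutativeRing)
open import Tactic.RingSolver.Core.Expression using (Expr; Κ; Ι; _⊕_; _⊗_; ⊝_; _⊛_; module Eval)
open import Tactic.RingSolver.Core.Polynomial.Parameters using (Homomorphism)
open import Defs

module WhomogeneousSets where
  open import Data.Nat.Base using (_+_; _≤_)

  Increasing : ∀ {m n} → (Fin m → Fin n) → Set
  Increasing f = ∀ {i j} → i < j → f i < f j

  increasing-injective : ∀ {m n} {f : Fin m → Fin n} → Increasing f → ∀ {i j} → i ≢ j → f i ≢ f j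
  increasing-injective {f = f} f↑ {i} {j} i≢j with <-cmp i j
  ... | tri< i<j _ _ = <⇒≢ (f↑ i<j)
  ... | tri≈ _ i≡j _ = ⊥-elim (i≢j i≡j)
  ... | tri> _ _ j<i = <⇒≢ (f↑ j<i) ∘ ≡.sym

  enumerate : ∀ {n} (V : Subset n) → Σ (Fin ∣ V ∣ → Fin n) λ f → (∀ i → f i ∈ V) × Increasing f
  enumerate [] = (λ ()) , (λ ()) , λ { {()} }
  enumerate (false ∷ V) with enumerate V
  ... | f , f∈V , f↑ = suc ∘ f , there ∘ f∈V , s≤s ∘ f↑
  enumerate (true ∷ V) with enumerate V
  ... | f , f∈V , f↑ = g , g∈V , g↑
    where
    g : Fin (ℕ.suc ∣ V ∣) → Fin _
    g zero    = zero
    g (suc i) = suc (f i)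
    g∈V : ∀ i → g i ∈ (true ∷ V)
    g∈V zero    = here
    g∈V (suc i) = there (f∈V i)
    g↑ : Increasing g
    g↑ {zero}  {suc j} _         = s≤s z≤n
    g↑ {suc i} {suc j} (s≤s i<j) = s≤s (f↑ i<j)

  module _ {α β γ : ℕ} where

    left : Fin α → Fin (α + β + γ)
    left i = (i ↑ˡ β) ↑ˡ γ

    middle : Fin β → Fin (α + β + γ)
    middle j = (α ↑ʳ j) ↑ˡ γ

    right : Fin γ → Fin (α + β + γ)
    right k = (α + β) ↑ʳ k

    left<middle : ∀ i j → left i < middle j
    left<middle i j =
      subst₂ ℕ._<_ (≡.sym (≡.trans (toℕ-↑ˡ _ γ) (toℕ-↑ˡ i β))) (≡.sym (≡.trans (toℕ-↑ˡ _ γ) (toℕ-↑ʳ α j)))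
      (ℕ.<-≤-trans (toℕ<n i) (ℕ.m≤m+n α (toℕ j)))

    middle<right : ∀ j k → middle j < right k
    middle<right j k = subst₂ ℕ._<_ (≡.sym (≡.trans (toℕ-↑ˡ _ γ) (toℕ-↑ʳ α j))) (≡.sym (toℕ-↑ʳ (α + β) k))
      (ℕ.<-≤-trans (ℕ.+-monoʳ-< α (toℕ<n j)) (ℕ.m≤m+n (α + β) (toℕ k)))

    left<right : ∀ i k → left i < right k
    left<right i k = subst₂ ℕ._<_ (≡.sym (≡.trans (toℕ-↑ˡ _ γ) (toℕ-↑ˡ i β))) (≡.sym (toℕ-↑ʳ (α + β) k))
      (ℕ.<-≤-trans (toℕ<n i) (ℕ.≤-trans (ℕ.m≤m+n α β) (ℕ.m≤m+n (α + β) (toℕ k))))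

    left-injective : ∀ {i i′} → i ≢ i′ → left i ≢ left i′
    left-injective i≢i′ = i≢i′ ∘ ↑ˡ-injective β _ _ ∘ ↑ˡ-injective γ _ _

    middle-injective : ∀ {j j′} → j ≢ j′ → middle j ≢ middle j′
    middle-injective j≢j′ = j≢j′ ∘ ↑ʳ-injective α _ _ ∘ ↑ˡ-injective γ _ _

    right-injective : ∀ {k k′} → k ≢ k′ → right k ≢ right k′
    right-injective k≢k′ = k≢k′ ∘ ↑ʳ-injective (α + β) _ _

  record Pencil {a ℓ} {A : Set a} (_≈_ : Rel A ℓ) {n} (C : Fin n → Fin n → Fin n → A) (s t : ℕ) : Set (a ⊔ ℓ) where
    field
      centre          : Fin n
      spoke           : Fin t → Fin n
      tip             : Fin s → Fin n
      centre≢spoke    : ∀ k → centre ≢ spoke k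
      centre≢tip      : ∀ i → centre ≢ tip i
      spoke-injective : ∀ {k l} → k ≢ l → spoke k ≢ spoke l
      tip-injective   : ∀ {i j} → i ≢ j → tip i ≢ tip j
      equicoloured    : ∀ k i j → C centre (spoke k) (tip i) ≈ C centre (spoke k) (tip j)

  module _ {a ℓ} (S : Setoid a ℓ) {n} {C : Fin n → Fin n → Fin n → Setoid.Carrier S}
           (swap₁₂ : ∀ x y z → Setoid._≈_ S (C x y z) (C y x z))
           (swap₂₃ : ∀ x y z → Setoid._≈_ S (C x y z) (C x z y)) where
    open Setoid S

    private
      module Blocks {I V} (H : IWhomog _≈_ C I V) (α β γ : ℕ) (size : α + β + γ ≤ ∣ V ∣) where
        enumeration : Σ (Fin ∣ V ∣ → Fin n) λ f → (∀ i → f i ∈ V) × Increasing f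
        enumeration = enumerate V

        g : Fin (α + β + γ) → Fin n
        g i = proj₁ enumeration (inject≤ i size)

        g∈V : ∀ i → g i ∈ V
        g∈V i = proj₁ (proj₂ enumeration) _

        g↑ : Increasing g
        g↑ {i} {j} i<j = proj₂ (proj₂ enumeration) (subst₂ ℕ._<_ (≡.sym (toℕ-inject≤ i size)) (≡.sym (toℕ-inject≤ j size)) i<j)

        first : Fin α → Fin n
        first = g ∘ left {α} {β} {γ}

        second : Fin β → Fin n
        second = g ∘ middle {α} {β} {γ}

        third : Fin γ → Fin n
        third = g ∘ right {α} {β} {γ}

        first≢second : ∀ i j → first i ≢ second j
        first≢second i j = <⇒≢ (g↑ (left<middle i j))

        second≢third : ∀ j k → second j ≢ third k
        second≢third j k = <⇒≢ (g↑ (middle<right j k))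

        first≢third : ∀ i k → first i ≢ third k
        first≢third i k = <⇒≢ (g↑ (left<right i k))

        first-injective : ∀ {i i′} → i ≢ i′ → first i ≢ first i′
        first-injective = increasing-injective g↑ ∘ left-injective {α} {β} {γ}

        second-injective : ∀ {j j′} → j ≢ j′ → second j ≢ second j′
        second-injective = increasing-injective g↑ ∘ middle-injective {α} {β} {γ}

        third-injective : ∀ {k k′} → k ≢ k′ → third k ≢ third k′
        third-injective = increasing-injective g↑ ∘ right-injective {α} {β} {γ}

        triple : ∀ i i′ j j′ k k′ →
          (zero ∈ I → i ≡ i′) → (suc zero ∈ I → j ≡ j′) → (suc (suc zero) ∈ I → k ≡ k′) →
          C (first i) (second j) (third k) ≈ C (first i′) (second j′) (third k′)
        triple i i′ j j′ k k′ e₁ e₂ e₃ = H _ _ _ _ _ _ (g∈V _) (g∈V _) (g∈V _) (g∈V _) (g∈V _) (g∈V _)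
          (g↑ (left<middle i j)) (g↑ (middle<right j k)) (g↑ (left<middle i′ j′)) (g↑ (middle<right j′ k′))
          (cong first ∘ e₁) (cong second ∘ e₂) (cong third ∘ e₃)

    pencil : ∀ {V} → Whomog _≈_ C V → ∀ s t → s + t ℕ.< ∣ V ∣ → Pencil _≈_ C s t
    pencil {V} (I , proper , H) s t s+t<∣V∣ with ¬∀⟶∃¬ 3 (_∈ I) (_∈? I) proper
    ... | zero , 0∉I = record
      { centre = second zero ; spoke = third ; tip = first
      ; centre≢spoke = second≢third zero
      ; centre≢tip = λ i → first≢second i zero ∘ ≡.sym
      ; spoke-injective = third-injective
      ; tip-injective = first-injective
      ; equicoloured = λ k i j → trans (rotate _ _ _)
          (trans (triple i j zero zero k k (⊥-elim ∘ 0∉I) (λ _ → ≡.refl) (λ _ → ≡.refl)) (sym (rotate _ _ _)))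
      }
      where
      open Blocks H s 1 t (subst (_≤ ∣ V ∣) (≡.sym (≡.trans (ℕ.+-assoc s 1 t) (ℕ.+-suc s t))) s+t<∣V∣)
      rotate : ∀ x y z → C x y z ≈ C z x y
      rotate x y z = trans (swap₂₃ x y z) (swap₁₂ x z y)
    ... | suc zero , 1∉I = record
      { centre = first zero ; spoke = third ; tip = second
      ; centre≢spoke = first≢third zero
      ; centre≢tip = first≢second zero
      ; spoke-injective = third-injective
      ; tip-injective = second-injective
      ; equicoloured = λ k i j → trans (swap₂₃ _ _ _)
          (trans (triple zero zero i j k k (λ _ → ≡.refl) (⊥-elim ∘ 1∉I) (λ _ → ≡.refl)) (swap₂₃ _ _ _))
      }
      where open Blocks H 1 s t s+t<∣V∣
    ... | suc (suc zero) , 2∉I = record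
      { centre = second zero ; spoke = first ; tip = third
      ; centre≢spoke = λ k → first≢second k zero ∘ ≡.sym
      ; centre≢tip = second≢third zero
      ; spoke-injective = first-injective
      ; tip-injective = third-injective
      ; equicoloured = λ k i j → trans (swap₁₂ _ _ _)
          (trans (triple k k zero zero i j (λ _ → ≡.refl) (λ _ → ≡.refl) (⊥-elim ∘ 2∉I)) (swap₁₂ _ _ _))
      }
      where
      open Blocks H t 1 s (subst (_≤ ∣ V ∣)
        (≡.sym (≡.trans (ℕ.+-assoc t 1 s) (≡.trans (ℕ.+-suc t s) (cong ℕ.suc (ℕ.+-comm t s))))) s+t<∣V∣)

  IWhomog-map : ∀ {a b ℓ ℓ′} {A : Set a} {B : Set b} (_≈_ : Rel A ℓ) (_≈′_ : Rel B ℓ′) {n}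
    {C : Fin n → Fin n → Fin n → A} {C′ : Fin n → Fin n → Fin n → B} →
    (∀ {x₁ x₂ x₃ y₁ y₂ y₃} → C x₁ x₂ x₃ ≈ C y₁ y₂ y₃ → C′ x₁ x₂ x₃ ≈′ C′ y₁ y₂ y₃) →
    ∀ {I V} → IWhomog _≈_ C I V → IWhomog _≈′_ C′ I V
  IWhomog-map _ _ transfer H x₁ x₂ x₃ y₁ y₂ y₃ m₁ m₂ m₃ n₁ n₂ n₃ o₁ o₂ o₃ o₄ e₁ e₂ e₃ =
    transfer (H x₁ x₂ x₃ y₁ y₂ y₃ m₁ m₂ m₃ n₁ n₂ n₃ o₁ o₂ o₃ o₄ e₁ e₂ e₃)

open WhomogeneousSets

-- The solver of the standard library takes its
-- coefficients from the ring itself and cannot cancel them without decidable equality, so here the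
-- coefficients are integers, written as differences of naturals and normalised.
module IntegerCoefficientSolver {c ℓ} (R : CommutativeRing c ℓ) where
  open CommutativeRing R
  open import Algebra.Properties.Semiring.Mult semiring using (×-homo-+; ×1-homo-*) renaming (_×_ to _·1_)
  open import Algebra.Properties.Ring ring using (-‿distribˡ-*; -‿distribʳ-*; -‿involutive; -0#≈0#)
  open import Algebra.Properties.AbelianGroup +-abelianGroup using (⁻¹-∙-comm)
  open import Algebra.Properties.CommutativeSemigroup +-commutativeSemigroup using (interchange)
  open import Relation.Binary.Reasoning.Setoid setoid

  Diff : Set
  Diff = ℕ × ℕ

  normalise : ℕ → ℕ → Diff
  normalise (suc a) (suc b) = normalise a b
  normalise a       b       = a , b

  rawDiff : RawRing 0ℓ 0ℓ
  rawDiff = record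
    { Carrier = Diff
    ; _≈_     = _≡_
    ; _+_     = λ (a , b) (c , d) → normalise (a ℕ.+ c) (b ℕ.+ d)
    ; _*_     = λ (a , b) (c , d) → normalise (a ℕ.* c ℕ.+ b ℕ.* d) (a ℕ.* d ℕ.+ b ℕ.* c)
    ; -_      = λ (a , b) → b , a
    ; 0#      = 0 , 0
    ; 1#      = 1 , 0
    }

  ⟦_⟧ᴰ : Diff → Carrier
  ⟦ a , b ⟧ᴰ = a ·1 1# + - (b ·1 1#)

  -‿+-distrib : ∀ x y → - (x + y) ≈ - x + - y
  -‿+-distrib x y = sym (⁻¹-∙-comm x y)

  normalise-sound : ∀ a b → ⟦ normalise a b ⟧ᴰ ≈ a ·1 1# + - (b ·1 1#)
  normalise-sound zero    b       = refl
  normalise-sound (suc a) zero    = refl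
  normalise-sound (suc a) (suc b) = begin
    ⟦ normalise a b ⟧ᴰ                      ≈⟨ normalise-sound a b ⟩
    a ·1 1# + - (b ·1 1#)                   ≈⟨ +-identityˡ _ ⟨
    0# + (a ·1 1# + - (b ·1 1#))            ≈⟨ +-congʳ (-‿inverseʳ 1#) ⟨
    (1# + - 1#) + (a ·1 1# + - (b ·1 1#))   ≈⟨ interchange _ _ _ _ ⟩
    (1# + a ·1 1#) + (- 1# + - (b ·1 1#))   ≈⟨ +-congˡ (-‿+-distrib 1# _) ⟨
    (1# + a ·1 1#) + - (1# + b ·1 1#)       ∎

  +-homo : ∀ a b c d → ⟦ normalise (a ℕ.+ c) (b ℕ.+ d) ⟧ᴰ ≈ ⟦ a , b ⟧ᴰ + ⟦ c , d ⟧ᴰ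
  +-homo a b c d = begin
    ⟦ normalise (a ℕ.+ c) (b ℕ.+ d) ⟧ᴰ          ≈⟨ normalise-sound (a ℕ.+ c) (b ℕ.+ d) ⟩
    (a ℕ.+ c) ·1 1# + - ((b ℕ.+ d) ·1 1#)      ≈⟨ +-cong (×-homo-+ 1# a c) (-‿cong (×-homo-+ 1# b d)) ⟩
    (a ·1 1# + c ·1 1#) + - (b ·1 1# + d ·1 1#) ≈⟨ +-congˡ (-‿+-distrib _ _) ⟩
    (a ·1 1# + c ·1 1#) + (- (b ·1 1#) + - (d ·1 1#)) ≈⟨ interchange _ _ _ _ ⟩
    ⟦ a , b ⟧ᴰ + ⟦ c , d ⟧ᴰ                      ∎

  *-difference : ∀ x y u v → (x + - y) * (u + - v) ≈ (x * u + y * v) + - (x * v + y * u)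
  *-difference x y u v = begin
    (x + - y) * (u + - v)                          ≈⟨ distribʳ _ x (- y) ⟩
    x * (u + - v) + - y * (u + - v)                ≈⟨ +-cong (distribˡ x u (- v)) (distribˡ (- y) u (- v)) ⟩
    (x * u + x * - v) + (- y * u + - y * - v)      ≈⟨ +-cong (+-congˡ (-‿distribʳ-* x v)) (+-cong (-‿distribˡ-* y u) -y*-v≈y*v) ⟨
    (x * u + - (x * v)) + (- (y * u) + y * v)      ≈⟨ +-congˡ (+-comm _ _) ⟩
    (x * u + - (x * v)) + (y * v + - (y * u))      ≈⟨ interchange _ _ _ _ ⟩
    (x * u + y * v) + (- (x * v) + - (y * u))      ≈⟨ +-congˡ (-‿+-distrib _ _) ⟨
    (x * u + y * v) + - (x * v + y * u)            ∎
    where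
    -y*-v≈y*v : y * v ≈ - y * - v
    -y*-v≈y*v = sym (trans (sym (-‿distribˡ-* y (- v))) (trans (-‿cong (sym (-‿distribʳ-* y v))) (-‿involutive _)))

  *-homo : ∀ a b c d → ⟦ normalise (a ℕ.* c ℕ.+ b ℕ.* d) (a ℕ.* d ℕ.+ b ℕ.* c) ⟧ᴰ ≈ ⟦ a , b ⟧ᴰ * ⟦ c , d ⟧ᴰ
  *-homo a b c d = begin
    ⟦ normalise (a ℕ.* c ℕ.+ b ℕ.* d) (a ℕ.* d ℕ.+ b ℕ.* c) ⟧ᴰ
      ≈⟨ normalise-sound (a ℕ.* c ℕ.+ b ℕ.* d) (a ℕ.* d ℕ.+ b ℕ.* c) ⟩
    (a ℕ.* c ℕ.+ b ℕ.* d) ·1 1# + - ((a ℕ.* d ℕ.+ b ℕ.* c) ·1 1#)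
      ≈⟨ +-cong (ι-+* a c b d) (-‿cong (ι-+* a d b c)) ⟩
    (ι a * ι c + ι b * ι d) + - (ι a * ι d + ι b * ι c)
      ≈⟨ *-difference (ι a) (ι b) (ι c) (ι d) ⟨
    ⟦ a , b ⟧ᴰ * ⟦ c , d ⟧ᴰ ∎
    where
    ι : ℕ → Carrier
    ι n = n ·1 1#
    ι-+* : ∀ p q r s → (p ℕ.* q ℕ.+ r ℕ.* s) ·1 1# ≈ ι p * ι q + ι r * ι s
    ι-+* p q r s = trans (×-homo-+ 1# (p ℕ.* q) (r ℕ.* s)) (+-cong (×1-homo-* p q) (×1-homo-* r s))

  homomorphism : Homomorphism 0ℓ 0ℓ c ℓ
  homomorphism = record
    { from = record { rawRing = rawDiff ; isZero = λ (a , b) → a ℕ.≡ᵇ b }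
    ; to = fromCommutativeRing R (λ _ → nothing)
    ; morphism = record
      { ⟦_⟧    = ⟦_⟧ᴰ
      ; +-homo = λ (a , b) (c , d) → +-homo a b c d
      ; *-homo = λ (a , b) (c , d) → *-homo a b c d
      ; -‿homo = λ _ → trans (+-comm _ _) (trans (+-congˡ (sym (-‿involutive _))) (sym (-‿+-distrib _ _)))
      ; 0-homo = -‿inverseʳ 0#
      ; 1-homo = trans (+-congˡ -0#≈0#) (trans (+-identityʳ _) (+-identityʳ 1#))
      }
    ; Zero-C⟶Zero-R = λ (a , b) a≡ᵇb → zero-sound a b (ℕ.≡ᵇ⇒≡ a b a≡ᵇb)
    }
    where
    zero-sound : ∀ a b → a ≡ b → 0# ≈ ⟦ a , b ⟧ᴰ
    zero-sound a .a ≡.refl = sym (-‿inverseʳ _)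

  private
    open Eval rawRing ⟦_⟧ᴰ
    open import Tactic.RingSolver.Core.Polynomial.Base (Homomorphism.from homomorphism)
    open import Tactic.RingSolver.Core.Polynomial.Semantics homomorphism renaming (⟦_⟧ to ⟦_⟧ₚ)
    open import Tactic.RingSolver.Core.Polynomial.Homomorphism homomorphism
    open import Algebra.Properties.Semiring.Exp.TCOptimised semiring using (^-congˡ)

    normalForm : ∀ {n} → Expr Diff n → Poly n
    normalForm (Κ x)   = κ x
    normalForm (Ι x)   = ι x
    normalForm (x ⊕ y) = normalForm x ⊞ normalForm y
    normalForm (x ⊗ y) = normalForm x ⊠ normalForm y
    normalForm (⊝ x)   = ⊟ normalForm x
    normalForm (x ⊛ i) = normalForm x ⊡ i

    ⟦_⇓⟧ : ∀ {n} → Expr Diff n → Vec Carrier n → Carrier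
    ⟦ e ⇓⟧ = ⟦ normalForm e ⟧ₚ

    normalForm-correct : ∀ {n} (e : Expr Diff n) ρ → ⟦ e ⇓⟧ ρ ≈ ⟦ e ⟧ ρ
    normalForm-correct (Κ x)   ρ = κ-hom x ρ
    normalForm-correct (Ι x)   ρ = ι-hom x ρ
    normalForm-correct (x ⊕ y) ρ = trans (⊞-hom (normalForm x) (normalForm y) ρ) (+-cong (normalForm-correct x ρ) (normalForm-correct y ρ))
    normalForm-correct (x ⊗ y) ρ = trans (⊠-hom (normalForm x) (normalForm y) ρ) (*-cong (normalForm-correct x ρ) (normalForm-correct y ρ))
    normalForm-correct (⊝ x)   ρ = trans (⊟-hom (normalForm x) ρ) (-‿cong (normalForm-correct x ρ))
    normalForm-correct (x ⊛ i) ρ = trans (⊡-hom (normalForm x) i ρ) (^-congˡ i (normalForm-correct x ρ))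

  open import Relation.Binary.Reflection setoid Ι ⟦_⟧ ⟦_⇓⟧ normalForm-correct public using (solve; _⊜_)

  -- so that the vector operations below can be written once, for ring elements and for solver expressions
  expressions : ℕ → RawRing 0ℓ 0ℓ
  expressions n = record
    { Carrier = Expr Diff n ; _≈_ = _≡_ ; _+_ = _⊕_ ; _*_ = _⊗_ ; -_ = ⊝_ ; 0# = Κ (0 , 0) ; 1# = Κ (1 , 0) }

module Coordinates {a ℓ} (A : RawRing a ℓ) where
  open RawRing A

  infixl 6 _-_ _+ᵛ_ _-ᵛ_ _+²_ _-²_
  infixl 7 _*ᵛ_ _·_ _∧_ _⨯_ _*²_
  infix 8 -ᵛ_
  infix 4 _≈ᵛ_ _≈²_

  _-_ : Carrier → Carrier → Carrier
  x - y = x + - y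

  Vector² : Set a
  Vector² = Carrier × Carrier

  _≈²_ : Vector² → Vector² → Set ℓ
  (a₁ , a₂) ≈² (b₁ , b₂) = (a₁ ≈ b₁) × (a₂ ≈ b₂)

  _+²_ _-²_ : Vector² → Vector² → Vector²
  (a₁ , a₂) +² (b₁ , b₂) = a₁ + b₁ , a₂ + b₂
  (a₁ , a₂) -² (b₁ , b₂) = a₁ - b₁ , a₂ - b₂

  _*²_ : Carrier → Vector² → Vector²
  s *² (a₁ , a₂) = s * a₁ , s * a₂

  0² : Vector²
  0² = 0# , 0#

  _∧_ : Vector² → Vector² → Carrier
  (a₁ , a₂) ∧ (b₁ , b₂) = a₁ * b₂ - a₂ * b₁

  Vector³ : Set a
  Vector³ = Carrier × Carrier × Carrier

  _≈ᵛ_ : Vector³ → Vector³ → Set ℓ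
  (a₁ , a₂ , a₃) ≈ᵛ (b₁ , b₂ , b₃) = (a₁ ≈ b₁) × (a₂ ≈ b₂) × (a₃ ≈ b₃)

  0ᵛ : Vector³
  0ᵛ = 0# , 0# , 0#

  _+ᵛ_ _-ᵛ_ _⨯_ : Vector³ → Vector³ → Vector³
  (a₁ , a₂ , a₃) +ᵛ (b₁ , b₂ , b₃) = a₁ + b₁ , a₂ + b₂ , a₃ + b₃
  (a₁ , a₂ , a₃) -ᵛ (b₁ , b₂ , b₃) = a₁ - b₁ , a₂ - b₂ , a₃ - b₃
  (a₁ , a₂ , a₃) ⨯ (b₁ , b₂ , b₃) = a₂ * b₃ - a₃ * b₂ , a₃ * b₁ - a₁ * b₃ , a₁ * b₂ - a₂ * b₁

  -ᵛ_ : Vector³ → Vector³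
  -ᵛ (a₁ , a₂ , a₃) = - a₁ , - a₂ , - a₃

  _*ᵛ_ : Carrier → Vector³ → Vector³
  s *ᵛ (a₁ , a₂ , a₃) = s * a₁ , s * a₂ , s * a₃

  _·_ : Vector³ → Vector³ → Carrier
  (a₁ , a₂ , a₃) · (b₁ , b₂ , b₃) = a₁ * b₁ + (a₂ * b₂ + a₃ * b₃)

  ∣_∣² : Vector³ → Carrier
  ∣ a ∣² = a · a

  -- ∣ n ∣² times the mirror image of x in the plane orthogonal to n
  mirror : Vector³ → Vector³ → Vector³
  mirror n x = ∣ n ∣² *ᵛ x -ᵛ (x · n + x · n) *ᵛ n

  -- 3 × 3 matrices, given by their columns
  Matrix : Set a
  Matrix = Vector³ × Vector³ × Vector³

  det : Matrix → Carrier
  det (u , v , w) = u · (v ⨯ w)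

  _⟨$⟩_ : Matrix → Vector³ → Vector³
  (u , v , w) ⟨$⟩ (a₁ , a₂ , a₃) = a₁ *ᵛ u +ᵛ a₂ *ᵛ v +ᵛ a₃ *ᵛ w

  cofactor : Matrix → Matrix
  cofactor (u , v , w) = v ⨯ w , w ⨯ u , u ⨯ v

  -- the coordinates of det M *ᵛ b in the basis M (Cramer's rule)
  cramer : Matrix → Vector³ → Vector³
  cramer (u , v , w) b = det (b , v , w) , det (u , b , w) , det (u , v , b)

  cremona : Vector³ → Vector³
  cremona (a₁ , a₂ , a₃) = a₁ * a₂ , a₁ * a₃ , a₂ * a₃

  record QuadraticForm : Set a where
    constructor quadraticForm
    field a₁₁ a₂₂ a₃₃ a₁₂ a₁₃ a₂₃ : Carrier

  polar : QuadraticForm → Vector³ → Vector³ → Carrier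
  polar (quadraticForm a₁₁ a₂₂ a₃₃ a₁₂ a₁₃ a₂₃) (u₁ , u₂ , u₃) (w₁ , w₂ , w₃) =
    a₁₁ * (u₁ * w₁) + a₂₂ * (u₂ * w₂) + a₃₃ * (u₃ * w₃)
      + a₁₂ * (u₁ * w₂ + u₂ * w₁) + a₁₃ * (u₁ * w₃ + u₃ * w₁) + a₂₃ * (u₂ * w₃ + u₃ * w₂)

  _⟦_⟧ : QuadraticForm → Vector³ → Carrier
  q ⟦ w ⟧ = polar q w w

  polarVector : QuadraticForm → Matrix → Vector³
  polarVector q (u , v , w) = polar q u v + polar q u v , polar q u w + polar q u w , polar q v w + polar q v w

  -- w ↦ (w · x)² − (w · y)² − (∣ x ∣² − ∣ y ∣²) ∣ w ∣², which is ∣ w ⨯ y ∣² − ∣ w ⨯ x ∣²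
  areaDifference : Vector³ → Vector³ → QuadraticForm
  areaDifference x@(x₁ , x₂ , x₃) y@(y₁ , y₂ , y₃) = quadraticForm
    (x₁ * x₁ - y₁ * y₁ - k) (x₂ * x₂ - y₂ * y₂ - k) (x₃ * x₃ - y₃ * y₃ - k)
    (x₁ * x₂ - y₁ * y₂) (x₁ * x₃ - y₁ * y₃) (x₂ * x₃ - y₂ * y₃)
    where
    k : Carrier
    k = ∣ x ∣² - ∣ y ∣²

module VectorAlgebra {c ℓ} (R : CommutativeRing c ℓ) where
  open CommutativeRing R hiding (_-_)
  open Coordinates rawRing public
  open IntegerCoefficientSolver R
  open import Algebra.Properties.Group +-group using (x∙y⁻¹≈ε⇒x≈y)
  open import Algebra.Properties.Ring ring using (-0#≈0#)
  private module E {n} = Coordinates (expressions n)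

  vectorSetoid : Setoid c ℓ
  vectorSetoid = setoid ×ₛ (setoid ×ₛ setoid)

  open Setoid vectorSetoid public using () renaming (refl to ≈ᵛ-refl; sym to ≈ᵛ-sym; trans to ≈ᵛ-trans)

  -- Each vector identity below is reduced, by pairing both sides with an arbitrary vector t, to a single
  -- scalar identity for the solver.
  ≈ᵛ-by-pairing : ∀ {u w} → (∀ t → t · u ≈ t · w) → u ≈ᵛ w
  ≈ᵛ-by-pairing {u₁ , u₂ , u₃} {w₁ , w₂ , w₃} h =
    trans (sym (e₁ u₁ u₂ u₃)) (trans (h _) (e₁ w₁ w₂ w₃)) ,
    trans (sym (e₂ u₁ u₂ u₃)) (trans (h _) (e₂ w₁ w₂ w₃)) ,
    trans (sym (e₃ u₁ u₂ u₃)) (trans (h _) (e₃ w₁ w₂ w₃))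
    where
    e₁ : ∀ x₁ x₂ x₃ → (1# , 0# , 0#) · (x₁ , x₂ , x₃) ≈ x₁
    e₁ x₁ x₂ x₃ = trans (+-cong (*-identityˡ x₁) (trans (+-cong (zeroˡ x₂) (zeroˡ x₃)) (+-identityˡ 0#))) (+-identityʳ x₁)
    e₂ : ∀ x₁ x₂ x₃ → (0# , 1# , 0#) · (x₁ , x₂ , x₃) ≈ x₂
    e₂ x₁ x₂ x₃ = trans (+-cong (zeroˡ x₁) (trans (+-cong (*-identityˡ x₂) (zeroˡ x₃)) (+-identityʳ x₂))) (+-identityˡ x₂)
    e₃ : ∀ x₁ x₂ x₃ → (0# , 0# , 1#) · (x₁ , x₂ , x₃) ≈ x₃
    e₃ x₁ x₂ x₃ = trans (+-cong (zeroˡ x₁) (trans (+-cong (zeroˡ x₂) (*-identityˡ x₃)) (+-identityˡ x₃))) (+-identityˡ x₃)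

  ·-cong : ∀ {u u′ w w′} → u ≈ᵛ u′ → w ≈ᵛ w′ → u · w ≈ u′ · w′
  ·-cong (p₁ , p₂ , p₃) (q₁ , q₂ , q₃) = +-cong (*-cong p₁ q₁) (+-cong (*-cong p₂ q₂) (*-cong p₃ q₃))

  *ᵛ-cong : ∀ {s s′ u u′} → s ≈ s′ → u ≈ᵛ u′ → s *ᵛ u ≈ᵛ s′ *ᵛ u′
  *ᵛ-cong p (q₁ , q₂ , q₃) = *-cong p q₁ , *-cong p q₂ , *-cong p q₃

  -ᵛ-congˡ : ∀ u {w w′} → w ≈ᵛ w′ → u -ᵛ w ≈ᵛ u -ᵛ w′
  -ᵛ-congˡ _ (q₁ , q₂ , q₃) = +-congˡ (-‿cong q₁) , +-congˡ (-‿cong q₂) , +-congˡ (-‿cong q₃)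

  ⨯-cong : ∀ {u u′ w w′} → u ≈ᵛ u′ → w ≈ᵛ w′ → u ⨯ w ≈ᵛ u′ ⨯ w′
  ⨯-cong (p₁ , p₂ , p₃) (q₁ , q₂ , q₃) =
    minus (*-cong p₂ q₃) (*-cong p₃ q₂) , minus (*-cong p₃ q₁) (*-cong p₁ q₃) , minus (*-cong p₁ q₂) (*-cong p₂ q₁)
    where
    minus : ∀ {x y x′ y′} → x ≈ x′ → y ≈ y′ → x - y ≈ x′ - y′
    minus p q = +-cong p (-‿cong q)

  ⟦⟧-cong : ∀ q {u w} → u ≈ᵛ w → q ⟦ u ⟧ ≈ q ⟦ w ⟧
  ⟦⟧-cong (quadraticForm a₁₁ a₂₂ a₃₃ a₁₂ a₁₃ a₂₃) (p₁ , p₂ , p₃) =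
    +-cong (+-cong (+-cong (+-cong (+-cong (*-congˡ (*-cong p₁ p₁)) (*-congˡ (*-cong p₂ p₂))) (*-congˡ (*-cong p₃ p₃)))
      (*-congˡ (+-cong (*-cong p₁ p₂) (*-cong p₂ p₁)))) (*-congˡ (+-cong (*-cong p₁ p₃) (*-cong p₃ p₁))))
      (*-congˡ (+-cong (*-cong p₂ p₃) (*-cong p₃ p₂)))

  x≈0⇒x*y≈0 : ∀ {x} y → x ≈ 0# → x * y ≈ 0#
  x≈0⇒x*y≈0 y x≈0 = trans (*-congʳ x≈0) (zeroˡ y)

  y≈0⇒x*y≈0 : ∀ x {y} → y ≈ 0# → x * y ≈ 0#
  y≈0⇒x*y≈0 x y≈0 = trans (*-congˡ y≈0) (zeroʳ x)

  x+y≈0 : ∀ {x y} → x ≈ 0# → y ≈ 0# → x + y ≈ 0#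
  x+y≈0 x≈0 y≈0 = trans (+-cong x≈0 y≈0) (+-identityʳ 0#)

  x≈0⇒x+y≈y : ∀ {x y} → x ≈ 0# → x + y ≈ y
  x≈0⇒x+y≈y {y = y} x≈0 = trans (+-congʳ x≈0) (+-identityˡ y)

  y≈0⇒x+y≈x : ∀ {x y} → y ≈ 0# → x + y ≈ x
  y≈0⇒x+y≈x {x} y≈0 = trans (+-congˡ y≈0) (+-identityʳ x)

  x≈0⇒-x≈0 : ∀ {x} → x ≈ 0# → - x ≈ 0#
  x≈0⇒-x≈0 x≈0 = trans (-‿cong x≈0) -0#≈0#

  x-y≈0 : ∀ {x y} → x ≈ 0# → y ≈ 0# → x - y ≈ 0#
  x-y≈0 x≈0 y≈0 = x+y≈0 x≈0 (x≈0⇒-x≈0 y≈0)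

  -ᵛ≈0ᵛ⇒≈ᵛ : ∀ {u w} → u -ᵛ w ≈ᵛ 0ᵛ → u ≈ᵛ w
  -ᵛ≈0ᵛ⇒≈ᵛ (p₁ , p₂ , p₃) = x∙y⁻¹≈ε⇒x≈y _ _ p₁ , x∙y⁻¹≈ε⇒x≈y _ _ p₂ , x∙y⁻¹≈ε⇒x≈y _ _ p₃

  *ᵛ-zeroˡ : ∀ {s} u → s ≈ 0# → s *ᵛ u ≈ᵛ 0ᵛ
  *ᵛ-zeroˡ (u₁ , u₂ , u₃) s≈0 = x≈0⇒x*y≈0 u₁ s≈0 , x≈0⇒x*y≈0 u₂ s≈0 , x≈0⇒x*y≈0 u₃ s≈0

  *ᵛ-zeroʳ : ∀ s {u} → u ≈ᵛ 0ᵛ → s *ᵛ u ≈ᵛ 0ᵛ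
  *ᵛ-zeroʳ s (p₁ , p₂ , p₃) = y≈0⇒x*y≈0 s p₁ , y≈0⇒x*y≈0 s p₂ , y≈0⇒x*y≈0 s p₃

  +ᵛ-≈0ᵛ : ∀ {u w} → u ≈ᵛ 0ᵛ → w ≈ᵛ 0ᵛ → u +ᵛ w ≈ᵛ 0ᵛ
  +ᵛ-≈0ᵛ (p₁ , p₂ , p₃) (q₁ , q₂ , q₃) = x+y≈0 p₁ q₁ , x+y≈0 p₂ q₂ , x+y≈0 p₃ q₃

  +ᵛ-identityʳ′ : ∀ u {w} → w ≈ᵛ 0ᵛ → u +ᵛ w ≈ᵛ u
  +ᵛ-identityʳ′ (u₁ , u₂ , u₃) (q₁ , q₂ , q₃) =
    trans (+-congˡ q₁) (+-identityʳ u₁) , trans (+-congˡ q₂) (+-identityʳ u₂) , trans (+-congˡ q₃) (+-identityʳ u₃)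

  ⨯-zeroˡ : ∀ {u} w → u ≈ᵛ 0ᵛ → u ⨯ w ≈ᵛ 0ᵛ
  ⨯-zeroˡ (w₁ , w₂ , w₃) (p₁ , p₂ , p₃) =
    x-y≈0 (x≈0⇒x*y≈0 w₃ p₂) (x≈0⇒x*y≈0 w₂ p₃) , x-y≈0 (x≈0⇒x*y≈0 w₁ p₃) (x≈0⇒x*y≈0 w₃ p₁) ,
    x-y≈0 (x≈0⇒x*y≈0 w₂ p₁) (x≈0⇒x*y≈0 w₁ p₂)

  ·-zeroʳ : ∀ u {w} → w ≈ᵛ 0ᵛ → u · w ≈ 0#
  ·-zeroʳ (u₁ , u₂ , u₃) (q₁ , q₂ , q₃) = x+y≈0 (y≈0⇒x*y≈0 u₁ q₁) (x+y≈0 (y≈0⇒x*y≈0 u₂ q₂) (y≈0⇒x*y≈0 u₃ q₃))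

  ⟨$⟩-zero : ∀ M {a} → a ≈ᵛ 0ᵛ → M ⟨$⟩ a ≈ᵛ 0ᵛ
  ⟨$⟩-zero (u , v , w) (p₁ , p₂ , p₃) = +ᵛ-≈0ᵛ (+ᵛ-≈0ᵛ (*ᵛ-zeroˡ u p₁) (*ᵛ-zeroˡ v p₂)) (*ᵛ-zeroˡ w p₃)

  ∧-zeroˡ : ∀ {u} w → u ≈² 0² → u ∧ w ≈ 0#
  ∧-zeroˡ (w₁ , w₂) (p₁ , p₂) = x-y≈0 (x≈0⇒x*y≈0 w₂ p₁) (x≈0⇒x*y≈0 w₁ p₂)

  ∧-zeroʳ : ∀ u {w} → w ≈² 0² → u ∧ w ≈ 0#
  ∧-zeroʳ (u₁ , u₂) (q₁ , q₂) = x-y≈0 (y≈0⇒x*y≈0 u₁ q₂) (y≈0⇒x*y≈0 u₂ q₁)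

  -- Identities in the plane

  ∧-square-difference : ∀ v x y → (v ∧ x) * (v ∧ x) - (v ∧ y) * (v ∧ y) ≈ (v ∧ (x -² y)) * (v ∧ (x +² y))
  ∧-square-difference (v₁ , v₂) (x₁ , x₂) (y₁ , y₂) =
    solve 6 (λ v₁ v₂ x₁ x₂ y₁ y₂ → let v = v₁ , v₂ ; x = x₁ , x₂ ; y = y₁ , y₂ in
      (v E.∧ x) ⊗ (v E.∧ x) E.- (v E.∧ y) ⊗ (v E.∧ y) ⊜ (v E.∧ (x E.-² y)) ⊗ (v E.∧ (x E.+² y)))
      refl v₁ v₂ x₁ x₂ y₁ y₂

  ∧-resolve : ∀ v v′ w → (v ∧ v′) *² w ≈² (v ∧ w) *² v′ -² (v′ ∧ w) *² v
  ∧-resolve (v₁ , v₂) (v₁′ , v₂′) (w₁ , w₂) =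
    solve 6 (λ v₁ v₂ v₁′ v₂′ w₁ w₂ → let v = v₁ , v₂ ; v′ = v₁′ , v₂′ ; w = w₁ , w₂ in
      (v E.∧ v′) ⊗ w₁ ⊜ (v E.∧ w) ⊗ v₁′ E.- (v′ E.∧ w) ⊗ v₁) refl v₁ v₂ v₁′ v₂′ w₁ w₂ ,
    solve 6 (λ v₁ v₂ v₁′ v₂′ w₁ w₂ → let v = v₁ , v₂ ; v′ = v₁′ , v₂′ ; w = w₁ , w₂ in
      (v E.∧ v′) ⊗ w₂ ⊜ (v E.∧ w) ⊗ v₂′ E.- (v′ E.∧ w) ⊗ v₂) refl v₁ v₂ v₁′ v₂′ w₁ w₂

  ∧-difference : ∀ x y → (x -² y) ∧ y ≈ x ∧ y
  ∧-difference (x₁ , x₂) (y₁ , y₂) =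
    solve 4 (λ x₁ x₂ y₁ y₂ → let x = x₁ , x₂ ; y = y₁ , y₂ in (x E.-² y) E.∧ y ⊜ x E.∧ y) refl x₁ x₂ y₁ y₂

  ∧-sum : ∀ x y → x ∧ (x +² y) ≈ x ∧ y
  ∧-sum (x₁ , x₂) (y₁ , y₂) =
    solve 4 (λ x₁ x₂ y₁ y₂ → let x = x₁ , x₂ ; y = y₁ , y₂ in x E.∧ (x E.+² y) ⊜ x E.∧ y) refl x₁ x₂ y₁ y₂

  -- Identities in space

  ⨯-self : ∀ u → u ⨯ u ≈ᵛ 0ᵛ
  ⨯-self (u₁ , u₂ , u₃) = -‿inverseʳ′ (*-comm u₂ u₃) , -‿inverseʳ′ (*-comm u₃ u₁) , -‿inverseʳ′ (*-comm u₁ u₂)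
    where
    -‿inverseʳ′ : ∀ {x y} → x ≈ y → x - y ≈ 0#
    -‿inverseʳ′ {y = y} x≈y = trans (+-congʳ x≈y) (-‿inverseʳ y)

  -ᵛ-⨯-self : ∀ u → (-ᵛ u) ⨯ u ≈ᵛ 0ᵛ
  -ᵛ-⨯-self (u₁ , u₂ , u₃) = ≈ᵛ-trans (≈ᵛ-by-pairing λ (t₁ , t₂ , t₃) →
    solve 6 (λ u₁ u₂ u₃ t₁ t₂ t₃ → let u = u₁ , u₂ , u₃ ; t = t₁ , t₂ , t₃ in
      t E.· ((E.-ᵛ u) E.⨯ u) ⊜ t E.· (u E.⨯ u)) refl u₁ u₂ u₃ t₁ t₂ t₃) (⨯-self (u₁ , u₂ , u₃))

  *ᵛ-⨯ˡ : ∀ s u w → (s *ᵛ u) ⨯ w ≈ᵛ s *ᵛ (u ⨯ w)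
  *ᵛ-⨯ˡ s (u₁ , u₂ , u₃) (w₁ , w₂ , w₃) = ≈ᵛ-by-pairing λ (t₁ , t₂ , t₃) →
    solve 10 (λ s u₁ u₂ u₃ w₁ w₂ w₃ t₁ t₂ t₃ → let u = u₁ , u₂ , u₃ ; w = w₁ , w₂ , w₃ ; t = t₁ , t₂ , t₃ in
      t E.· ((s E.*ᵛ u) E.⨯ w) ⊜ t E.· (s E.*ᵛ (u E.⨯ w))) refl s u₁ u₂ u₃ w₁ w₂ w₃ t₁ t₂ t₃

  ⨯-*ᵛʳ : ∀ s u w → u ⨯ (s *ᵛ w) ≈ᵛ s *ᵛ (u ⨯ w)
  ⨯-*ᵛʳ s (u₁ , u₂ , u₃) (w₁ , w₂ , w₃) = ≈ᵛ-by-pairing λ (t₁ , t₂ , t₃) →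
    solve 10 (λ s u₁ u₂ u₃ w₁ w₂ w₃ t₁ t₂ t₃ → let u = u₁ , u₂ , u₃ ; w = w₁ , w₂ , w₃ ; t = t₁ , t₂ , t₃ in
      t E.· (u E.⨯ (s E.*ᵛ w)) ⊜ t E.· (s E.*ᵛ (u E.⨯ w))) refl s u₁ u₂ u₃ w₁ w₂ w₃ t₁ t₂ t₃

  *ᵛ-⨯-*ᵛ : ∀ l m u w → (l *ᵛ u) ⨯ (m *ᵛ w) ≈ᵛ (l * m) *ᵛ (u ⨯ w)
  *ᵛ-⨯-*ᵛ l m (u₁ , u₂ , u₃) (w₁ , w₂ , w₃) = ≈ᵛ-by-pairing λ (t₁ , t₂ , t₃) →
    solve 11 (λ l m u₁ u₂ u₃ w₁ w₂ w₃ t₁ t₂ t₃ → let u = u₁ , u₂ , u₃ ; w = w₁ , w₂ , w₃ ; t = t₁ , t₂ , t₃ in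
      t E.· ((l E.*ᵛ u) E.⨯ (m E.*ᵛ w)) ⊜ t E.· ((l ⊗ m) E.*ᵛ (u E.⨯ w))) refl l m u₁ u₂ u₃ w₁ w₂ w₃ t₁ t₂ t₃

  -ᵛ-⨯ : ∀ x y → (x -ᵛ y) ⨯ y ≈ᵛ x ⨯ y
  -ᵛ-⨯ (x₁ , x₂ , x₃) (y₁ , y₂ , y₃) = ≈ᵛ-by-pairing λ (t₁ , t₂ , t₃) →
    solve 9 (λ x₁ x₂ x₃ y₁ y₂ y₃ t₁ t₂ t₃ → let x = x₁ , x₂ , x₃ ; y = y₁ , y₂ , y₃ ; t = t₁ , t₂ , t₃ in
      t E.· ((x E.-ᵛ y) E.⨯ y) ⊜ t E.· (x E.⨯ y)) refl x₁ x₂ x₃ y₁ y₂ y₃ t₁ t₂ t₃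

  -ᵛ-ᵛ-⨯ : ∀ x y → (x -ᵛ -ᵛ y) ⨯ y ≈ᵛ x ⨯ y
  -ᵛ-ᵛ-⨯ (x₁ , x₂ , x₃) (y₁ , y₂ , y₃) = ≈ᵛ-by-pairing λ (t₁ , t₂ , t₃) →
    solve 9 (λ x₁ x₂ x₃ y₁ y₂ y₃ t₁ t₂ t₃ → let x = x₁ , x₂ , x₃ ; y = y₁ , y₂ , y₃ ; t = t₁ , t₂ , t₃ in
      t E.· ((x E.-ᵛ E.-ᵛ y) E.⨯ y) ⊜ t E.· (x E.⨯ y)) refl x₁ x₂ x₃ y₁ y₂ y₃ t₁ t₂ t₃

  pair-⨯ˡ : ∀ l m a b → a ⨯ (l *ᵛ a +ᵛ m *ᵛ b) ≈ᵛ m *ᵛ (a ⨯ b)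
  pair-⨯ˡ l m (a₁ , a₂ , a₃) (b₁ , b₂ , b₃) = ≈ᵛ-by-pairing λ (t₁ , t₂ , t₃) →
    solve 11 (λ l m a₁ a₂ a₃ b₁ b₂ b₃ t₁ t₂ t₃ → let a = a₁ , a₂ , a₃ ; b = b₁ , b₂ , b₃ ; t = t₁ , t₂ , t₃ in
      t E.· (a E.⨯ (l E.*ᵛ a E.+ᵛ m E.*ᵛ b)) ⊜ t E.· (m E.*ᵛ (a E.⨯ b))) refl l m a₁ a₂ a₃ b₁ b₂ b₃ t₁ t₂ t₃

  pair-⨯ʳ : ∀ l m a b → (l *ᵛ a +ᵛ m *ᵛ b) ⨯ b ≈ᵛ l *ᵛ (a ⨯ b)
  pair-⨯ʳ l m (a₁ , a₂ , a₃) (b₁ , b₂ , b₃) = ≈ᵛ-by-pairing λ (t₁ , t₂ , t₃) →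
    solve 11 (λ l m a₁ a₂ a₃ b₁ b₂ b₃ t₁ t₂ t₃ → let a = a₁ , a₂ , a₃ ; b = b₁ , b₂ , b₃ ; t = t₁ , t₂ , t₃ in
      t E.· ((l E.*ᵛ a E.+ᵛ m E.*ᵛ b) E.⨯ b) ⊜ t E.· (l E.*ᵛ (a E.⨯ b))) refl l m a₁ a₂ a₃ b₁ b₂ b₃ t₁ t₂ t₃

  ·-*ᵛʳ : ∀ s u w → u · (s *ᵛ w) ≈ s * (u · w)
  ·-*ᵛʳ s (u₁ , u₂ , u₃) (w₁ , w₂ , w₃) =
    solve 7 (λ s u₁ u₂ u₃ w₁ w₂ w₃ → let u = u₁ , u₂ , u₃ ; w = w₁ , w₂ , w₃ in
      u E.· (s E.*ᵛ w) ⊜ s ⊗ (u E.· w)) refl s u₁ u₂ u₃ w₁ w₂ w₃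

  ·-pair : ∀ l m a b u → (l *ᵛ a +ᵛ m *ᵛ b) · u ≈ l * (a · u) + m * (b · u)
  ·-pair l m (a₁ , a₂ , a₃) (b₁ , b₂ , b₃) (u₁ , u₂ , u₃) =
    solve 11 (λ l m a₁ a₂ a₃ b₁ b₂ b₃ u₁ u₂ u₃ → let a = a₁ , a₂ , a₃ ; b = b₁ , b₂ , b₃ ; u = u₁ , u₂ , u₃ in
      (l E.*ᵛ a E.+ᵛ m E.*ᵛ b) E.· u ⊜ l ⊗ (a E.· u) ⊕ m ⊗ (b E.· u)) refl l m a₁ a₂ a₃ b₁ b₂ b₃ u₁ u₂ u₃

  ∣*ᵛ∣² : ∀ s u → ∣ s *ᵛ u ∣² ≈ (s * s) * ∣ u ∣²
  ∣*ᵛ∣² s (u₁ , u₂ , u₃) =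
    solve 4 (λ s u₁ u₂ u₃ → let u = u₁ , u₂ , u₃ in E.∣ s E.*ᵛ u ∣² ⊜ (s ⊗ s) ⊗ E.∣ u ∣²) refl s u₁ u₂ u₃

  ∣-ᵛ∣² : ∀ u → ∣ -ᵛ u ∣² ≈ ∣ u ∣²
  ∣-ᵛ∣² (u₁ , u₂ , u₃) = solve 3 (λ u₁ u₂ u₃ → let u = u₁ , u₂ , u₃ in E.∣ E.-ᵛ u ∣² ⊜ E.∣ u ∣²) refl u₁ u₂ u₃

  ∣⨯∣²-comm : ∀ u w → ∣ u ⨯ w ∣² ≈ ∣ w ⨯ u ∣²
  ∣⨯∣²-comm (u₁ , u₂ , u₃) (w₁ , w₂ , w₃) =
    solve 6 (λ u₁ u₂ u₃ w₁ w₂ w₃ → let u = u₁ , u₂ , u₃ ; w = w₁ , w₂ , w₃ in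
      E.∣ u E.⨯ w ∣² ⊜ E.∣ w E.⨯ u ∣²) refl u₁ u₂ u₃ w₁ w₂ w₃

  ∣-ᵛ∣²-polarisation : ∀ x w → ∣ x -ᵛ w ∣² ≈ (x · (x -ᵛ w) + x · (x -ᵛ w)) - (∣ x ∣² - ∣ w ∣²)
  ∣-ᵛ∣²-polarisation (x₁ , x₂ , x₃) (w₁ , w₂ , w₃) =
    solve 6 (λ x₁ x₂ x₃ w₁ w₂ w₃ → let x = x₁ , x₂ , x₃ ; w = w₁ , w₂ , w₃ in
      E.∣ x E.-ᵛ w ∣² ⊜ (x E.· (x E.-ᵛ w) ⊕ x E.· (x E.-ᵛ w)) E.- (E.∣ x ∣² E.- E.∣ w ∣²)) refl x₁ x₂ x₃ w₁ w₂ w₃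

  *ᵛ-difference : ∀ s x w → s *ᵛ w ≈ᵛ s *ᵛ x -ᵛ s *ᵛ (x -ᵛ w)
  *ᵛ-difference s (x₁ , x₂ , x₃) (w₁ , w₂ , w₃) = ≈ᵛ-by-pairing λ (t₁ , t₂ , t₃) →
    solve 10 (λ s x₁ x₂ x₃ w₁ w₂ w₃ t₁ t₂ t₃ → let x = x₁ , x₂ , x₃ ; w = w₁ , w₂ , w₃ ; t = t₁ , t₂ , t₃ in
      t E.· (s E.*ᵛ w) ⊜ t E.· (s E.*ᵛ x E.-ᵛ s E.*ᵛ (x E.-ᵛ w))) refl s x₁ x₂ x₃ w₁ w₂ w₃ t₁ t₂ t₃

  det-cyclic : ∀ a b c → det (a , b , c) ≈ c · (a ⨯ b)
  det-cyclic (a₁ , a₂ , a₃) (b₁ , b₂ , b₃) (c₁ , c₂ , c₃) =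
    solve 9 (λ a₁ a₂ a₃ b₁ b₂ b₃ c₁ c₂ c₃ → let a = a₁ , a₂ , a₃ ; b = b₁ , b₂ , b₃ ; c = c₁ , c₂ , c₃ in
      E.det (a , b , c) ⊜ c E.· (a E.⨯ b)) refl a₁ a₂ a₃ b₁ b₂ b₃ c₁ c₂ c₃

  bac-cab : ∀ a b c → (a ⨯ b) ⨯ c ≈ᵛ (- (b · c)) *ᵛ a +ᵛ (a · c) *ᵛ b
  bac-cab (a₁ , a₂ , a₃) (b₁ , b₂ , b₃) (c₁ , c₂ , c₃) = ≈ᵛ-by-pairing λ (t₁ , t₂ , t₃) →
    solve 12 (λ a₁ a₂ a₃ b₁ b₂ b₃ c₁ c₂ c₃ t₁ t₂ t₃ →
      let a = a₁ , a₂ , a₃ ; b = b₁ , b₂ , b₃ ; c = c₁ , c₂ , c₃ ; t = t₁ , t₂ , t₃ in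
      t E.· ((a E.⨯ b) E.⨯ c) ⊜ t E.· ((⊝ (b E.· c)) E.*ᵛ a E.+ᵛ (a E.· c) E.*ᵛ b))
      refl a₁ a₂ a₃ b₁ b₂ b₃ c₁ c₂ c₃ t₁ t₂ t₃

  ⨯-⨯-self : ∀ a b → (a ⨯ b) ⨯ a ≈ᵛ ∣ a ∣² *ᵛ b -ᵛ (b · a) *ᵛ a
  ⨯-⨯-self (a₁ , a₂ , a₃) (b₁ , b₂ , b₃) = ≈ᵛ-by-pairing λ (t₁ , t₂ , t₃) →
    solve 9 (λ a₁ a₂ a₃ b₁ b₂ b₃ t₁ t₂ t₃ → let a = a₁ , a₂ , a₃ ; b = b₁ , b₂ , b₃ ; t = t₁ , t₂ , t₃ in
      t E.· ((a E.⨯ b) E.⨯ a) ⊜ t E.· (E.∣ a ∣² E.*ᵛ b E.-ᵛ (b E.· a) E.*ᵛ a)) refl a₁ a₂ a₃ b₁ b₂ b₃ t₁ t₂ t₃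

  parallel-projection : ∀ {n u} → n ⨯ u ≈ᵛ 0ᵛ → ∣ n ∣² *ᵛ u ≈ᵛ (u · n) *ᵛ n
  parallel-projection {n} {u} n∥u = -ᵛ≈0ᵛ⇒≈ᵛ (≈ᵛ-trans (≈ᵛ-sym (⨯-⨯-self n u)) (⨯-zeroˡ n n∥u))

  plane-decomposition : ∀ a b c → ∣ a ⨯ b ∣² *ᵛ c ≈ᵛ
    ((c ⨯ b) · (a ⨯ b)) *ᵛ a +ᵛ ((a ⨯ c) · (a ⨯ b)) *ᵛ b +ᵛ (c · (a ⨯ b)) *ᵛ (a ⨯ b)
  plane-decomposition (a₁ , a₂ , a₃) (b₁ , b₂ , b₃) (c₁ , c₂ , c₃) = ≈ᵛ-by-pairing λ (t₁ , t₂ , t₃) →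
    solve 12 (λ a₁ a₂ a₃ b₁ b₂ b₃ c₁ c₂ c₃ t₁ t₂ t₃ →
      let a = a₁ , a₂ , a₃ ; b = b₁ , b₂ , b₃ ; c = c₁ , c₂ , c₃ ; t = t₁ , t₂ , t₃ ; n = a E.⨯ b in
      t E.· (E.∣ n ∣² E.*ᵛ c) ⊜ t E.· (((c E.⨯ b) E.· n) E.*ᵛ a E.+ᵛ ((a E.⨯ c) E.· n) E.*ᵛ b E.+ᵛ (c E.· n) E.*ᵛ n))
      refl a₁ a₂ a₃ b₁ b₂ b₃ c₁ c₂ c₃ t₁ t₂ t₃

  binet-cauchy : ∀ a b c d → (a · c) * (b · d) - (a · d) * (b · c) ≈ (a ⨯ b) · (c ⨯ d)
  binet-cauchy (a₁ , a₂ , a₃) (b₁ , b₂ , b₃) (c₁ , c₂ , c₃) (d₁ , d₂ , d₃) =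
    solve 12 (λ a₁ a₂ a₃ b₁ b₂ b₃ c₁ c₂ c₃ d₁ d₂ d₃ →
      let a = a₁ , a₂ , a₃ ; b = b₁ , b₂ , b₃ ; c = c₁ , c₂ , c₃ ; d = d₁ , d₂ , d₃ in
      (a E.· c) ⊗ (b E.· d) E.- (a E.· d) ⊗ (b E.· c) ⊜ (a E.⨯ b) E.· (c E.⨯ d))
      refl a₁ a₂ a₃ b₁ b₂ b₃ c₁ c₂ c₃ d₁ d₂ d₃

  ∣mirror∣² : ∀ n x → ∣ mirror n x ∣² ≈ (∣ n ∣² * ∣ n ∣²) * ∣ x ∣²
  ∣mirror∣² (n₁ , n₂ , n₃) (x₁ , x₂ , x₃) =
    solve 6 (λ n₁ n₂ n₃ x₁ x₂ x₃ → let n = n₁ , n₂ , n₃ ; x = x₁ , x₂ , x₃ in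
      E.∣ E.mirror n x ∣² ⊜ (E.∣ n ∣² ⊗ E.∣ n ∣²) ⊗ E.∣ x ∣²) refl n₁ n₂ n₃ x₁ x₂ x₃

  cramer-rule : ∀ M w → det M *ᵛ w ≈ᵛ M ⟨$⟩ cramer M w
  cramer-rule ((a₁ , a₂ , a₃) , (b₁ , b₂ , b₃) , (c₁ , c₂ , c₃)) (w₁ , w₂ , w₃) = ≈ᵛ-by-pairing λ (t₁ , t₂ , t₃) →
    solve 15 (λ a₁ a₂ a₃ b₁ b₂ b₃ c₁ c₂ c₃ w₁ w₂ w₃ t₁ t₂ t₃ →
      let M = (a₁ , a₂ , a₃) , (b₁ , b₂ , b₃) , (c₁ , c₂ , c₃) ; w = w₁ , w₂ , w₃ ; t = t₁ , t₂ , t₃ in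
      t E.· (E.det M E.*ᵛ w) ⊜ t E.· (M E.⟨$⟩ E.cramer M w))
      refl a₁ a₂ a₃ b₁ b₂ b₃ c₁ c₂ c₃ w₁ w₂ w₃ t₁ t₂ t₃

  ⟨$⟩-⨯ : ∀ M a b → (M ⟨$⟩ a) ⨯ (M ⟨$⟩ b) ≈ᵛ cofactor M ⟨$⟩ (a ⨯ b)
  ⟨$⟩-⨯ ((u₁ , u₂ , u₃) , (v₁ , v₂ , v₃) , (w₁ , w₂ , w₃)) (a₁ , a₂ , a₃) (b₁ , b₂ , b₃) = ≈ᵛ-by-pairing λ (t₁ , t₂ , t₃) →
    solve 18 (λ u₁ u₂ u₃ v₁ v₂ v₃ w₁ w₂ w₃ a₁ a₂ a₃ b₁ b₂ b₃ t₁ t₂ t₃ →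
      let M = (u₁ , u₂ , u₃) , (v₁ , v₂ , v₃) , (w₁ , w₂ , w₃) ; a = a₁ , a₂ , a₃ ; b = b₁ , b₂ , b₃ ; t = t₁ , t₂ , t₃ in
      t E.· ((M E.⟨$⟩ a) E.⨯ (M E.⟨$⟩ b)) ⊜ t E.· (E.cofactor M E.⟨$⟩ (a E.⨯ b)))
      refl u₁ u₂ u₃ v₁ v₂ v₃ w₁ w₂ w₃ a₁ a₂ a₃ b₁ b₂ b₃ t₁ t₂ t₃

  cremona-⨯ : ∀ c₁ c₂ c₃ k₁ k₂ k₃ → cremona (c₁ , c₂ , c₃) ⨯ cremona (k₁ , k₂ , k₃) ≈ᵛ
    ((c₃ * k₃) * (c₁ * k₂ - c₂ * k₁) , (c₂ * k₂) * (c₃ * k₁ - c₁ * k₃) , (c₁ * k₁) * (c₂ * k₃ - c₃ * k₂))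
  cremona-⨯ c₁ c₂ c₃ k₁ k₂ k₃ = ≈ᵛ-by-pairing λ (t₁ , t₂ , t₃) →
    solve 9 (λ c₁ c₂ c₃ k₁ k₂ k₃ t₁ t₂ t₃ → let t = t₁ , t₂ , t₃ in
      t E.· (E.cremona (c₁ , c₂ , c₃) E.⨯ E.cremona (k₁ , k₂ , k₃)) ⊜
      t E.· ((c₃ ⊗ k₃) ⊗ (c₁ ⊗ k₂ E.- c₂ ⊗ k₁) , (c₂ ⊗ k₂) ⊗ (c₃ ⊗ k₁ E.- c₁ ⊗ k₃) , (c₁ ⊗ k₁) ⊗ (c₂ ⊗ k₃ E.- c₃ ⊗ k₂)))
      refl c₁ c₂ c₃ k₁ k₂ k₃ t₁ t₂ t₃

  -- Quadratic forms

  value-*ᵛ : ∀ q s w → q ⟦ s *ᵛ w ⟧ ≈ (s * s) * q ⟦ w ⟧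
  value-*ᵛ (quadraticForm a₁₁ a₂₂ a₃₃ a₁₂ a₁₃ a₂₃) s (w₁ , w₂ , w₃) =
    solve 10 (λ a₁₁ a₂₂ a₃₃ a₁₂ a₁₃ a₂₃ s w₁ w₂ w₃ →
      let q = E.quadraticForm a₁₁ a₂₂ a₃₃ a₁₂ a₁₃ a₂₃ ; w = w₁ , w₂ , w₃ in
      q E.⟦ s E.*ᵛ w ⟧ ⊜ (s ⊗ s) ⊗ q E.⟦ w ⟧) refl a₁₁ a₂₂ a₃₃ a₁₂ a₁₃ a₂₃ s w₁ w₂ w₃

  value-pair : ∀ q l m a b → q ⟦ l *ᵛ a +ᵛ m *ᵛ b ⟧ ≈ (l * l) * q ⟦ a ⟧ + (m * m) * q ⟦ b ⟧ + (l * m) * (polar q a b + polar q a b)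
  value-pair (quadraticForm a₁₁ a₂₂ a₃₃ a₁₂ a₁₃ a₂₃) l m (a₁ , a₂ , a₃) (b₁ , b₂ , b₃) =
    solve 14 (λ a₁₁ a₂₂ a₃₃ a₁₂ a₁₃ a₂₃ l m a₁ a₂ a₃ b₁ b₂ b₃ →
      let q = E.quadraticForm a₁₁ a₂₂ a₃₃ a₁₂ a₁₃ a₂₃ ; a = a₁ , a₂ , a₃ ; b = b₁ , b₂ , b₃ in
      q E.⟦ l E.*ᵛ a E.+ᵛ m E.*ᵛ b ⟧ ⊜ (l ⊗ l) ⊗ q E.⟦ a ⟧ ⊕ (m ⊗ m) ⊗ q E.⟦ b ⟧ ⊕ (l ⊗ m) ⊗ (E.polar q a b ⊕ E.polar q a b))
      refl a₁₁ a₂₂ a₃₃ a₁₂ a₁₃ a₂₃ l m a₁ a₂ a₃ b₁ b₂ b₃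

  value-⟨$⟩ : ∀ q u v w l₁ l₂ l₃ → let M = u , v , w ; l = l₁ , l₂ , l₃ in
    q ⟦ M ⟨$⟩ l ⟧ ≈ (l₁ * l₁) * q ⟦ u ⟧ + (l₂ * l₂) * q ⟦ v ⟧ + (l₃ * l₃) * q ⟦ w ⟧ + cremona l · polarVector q M
  value-⟨$⟩ (quadraticForm a₁₁ a₂₂ a₃₃ a₁₂ a₁₃ a₂₃) (u₁ , u₂ , u₃) (v₁ , v₂ , v₃) (w₁ , w₂ , w₃) l₁ l₂ l₃ =
    solve 18 (λ a₁₁ a₂₂ a₃₃ a₁₂ a₁₃ a₂₃ u₁ u₂ u₃ v₁ v₂ v₃ w₁ w₂ w₃ l₁ l₂ l₃ →
      let q = E.quadraticForm a₁₁ a₂₂ a₃₃ a₁₂ a₁₃ a₂₃ ; u = u₁ , u₂ , u₃ ; v = v₁ , v₂ , v₃ ; w = w₁ , w₂ , w₃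
          M = u , v , w ; l = l₁ , l₂ , l₃ in
      q E.⟦ M E.⟨$⟩ l ⟧ ⊜ (l₁ ⊗ l₁) ⊗ q E.⟦ u ⟧ ⊕ (l₂ ⊗ l₂) ⊗ q E.⟦ v ⟧ ⊕ (l₃ ⊗ l₃) ⊗ q E.⟦ w ⟧ ⊕ E.cremona l E.· E.polarVector q M)
      refl a₁₁ a₂₂ a₃₃ a₁₂ a₁₃ a₂₃ u₁ u₂ u₃ v₁ v₂ v₃ w₁ w₂ w₃ l₁ l₂ l₃

  areaDifference-value : ∀ x y w → areaDifference x y ⟦ w ⟧ ≈ ∣ w ⨯ y ∣² - ∣ w ⨯ x ∣²
  areaDifference-value (x₁ , x₂ , x₃) (y₁ , y₂ , y₃) (w₁ , w₂ , w₃) =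
    solve 9 (λ x₁ x₂ x₃ y₁ y₂ y₃ w₁ w₂ w₃ → let x = x₁ , x₂ , x₃ ; y = y₁ , y₂ , y₃ ; w = w₁ , w₂ , w₃ in
      E.areaDifference x y E.⟦ w ⟧ ⊜ E.∣ w E.⨯ y ∣² E.- E.∣ w E.⨯ x ∣²) refl x₁ x₂ x₃ y₁ y₂ y₃ w₁ w₂ w₃

  areaDifference-factorisation : ∀ x y w →
    areaDifference x y ⟦ w ⟧ ≈ (w · (x -ᵛ y)) * (w · (x -ᵛ -ᵛ y)) - (∣ x ∣² - ∣ y ∣²) * ∣ w ∣²
  areaDifference-factorisation (x₁ , x₂ , x₃) (y₁ , y₂ , y₃) (w₁ , w₂ , w₃) =
    solve 9 (λ x₁ x₂ x₃ y₁ y₂ y₃ w₁ w₂ w₃ → let x = x₁ , x₂ , x₃ ; y = y₁ , y₂ , y₃ ; w = w₁ , w₂ , w₃ in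
      E.areaDifference x y E.⟦ w ⟧ ⊜ (w E.· (x E.-ᵛ y)) ⊗ (w E.· (x E.-ᵛ E.-ᵛ y)) E.- (E.∣ x ∣² E.- E.∣ y ∣²) ⊗ E.∣ w ∣²)
      refl x₁ x₂ x₃ y₁ y₂ y₃ w₁ w₂ w₃

  areaDifference-normals : ∀ n x y →
    areaDifference x y ⟦ n ⨯ x ⟧ + areaDifference x y ⟦ n ⨯ y ⟧ ≈ - ((∣ x ∣² - ∣ y ∣²) * (∣ n ⨯ x ∣² + ∣ n ⨯ y ∣²))
  areaDifference-normals (n₁ , n₂ , n₃) (x₁ , x₂ , x₃) (y₁ , y₂ , y₃) =
    solve 9 (λ n₁ n₂ n₃ x₁ x₂ x₃ y₁ y₂ y₃ → let n = n₁ , n₂ , n₃ ; x = x₁ , x₂ , x₃ ; y = y₁ , y₂ , y₃ in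
      E.areaDifference x y E.⟦ n E.⨯ x ⟧ ⊕ E.areaDifference x y E.⟦ n E.⨯ y ⟧ ⊜
      ⊝ ((E.∣ x ∣² E.- E.∣ y ∣²) ⊗ (E.∣ n E.⨯ x ∣² ⊕ E.∣ n E.⨯ y ∣²)))
      refl n₁ n₂ n₃ x₁ x₂ x₃ y₁ y₂ y₃

  areaDifference-first : ∀ x y → areaDifference x y ⟦ x ⟧ ≈ ∣ x ⨯ y ∣²
  areaDifference-first (x₁ , x₂ , x₃) (y₁ , y₂ , y₃) =
    solve 6 (λ x₁ x₂ x₃ y₁ y₂ y₃ → let x = x₁ , x₂ , x₃ ; y = y₁ , y₂ , y₃ in
      E.areaDifference x y E.⟦ x ⟧ ⊜ E.∣ x E.⨯ y ∣²) refl x₁ x₂ x₃ y₁ y₂ y₃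

  areaDifference-second : ∀ x y → areaDifference x y ⟦ y ⟧ ≈ - ∣ x ⨯ y ∣²
  areaDifference-second (x₁ , x₂ , x₃) (y₁ , y₂ , y₃) =
    solve 6 (λ x₁ x₂ x₃ y₁ y₂ y₃ → let x = x₁ , x₂ , x₃ ; y = y₁ , y₂ , y₃ in
      E.areaDifference x y E.⟦ y ⟧ ⊜ ⊝ E.∣ x E.⨯ y ∣²) refl x₁ x₂ x₃ y₁ y₂ y₃

  areaDifference-third : ∀ x y z → areaDifference x y ⟦ z ⟧ + areaDifference x z ⟦ x ⟧ ≈ ∣ y ⨯ z ∣²
  areaDifference-third (x₁ , x₂ , x₃) (y₁ , y₂ , y₃) (z₁ , z₂ , z₃) =
    solve 9 (λ x₁ x₂ x₃ y₁ y₂ y₃ z₁ z₂ z₃ → let x = x₁ , x₂ , x₃ ; y = y₁ , y₂ , y₃ ; z = z₁ , z₂ , z₃ in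
      E.areaDifference x y E.⟦ z ⟧ ⊕ E.areaDifference x z E.⟦ x ⟧ ⊜ E.∣ y E.⨯ z ∣²) refl x₁ x₂ x₃ y₁ y₂ y₃ z₁ z₂ z₃

module RealFieldProperties (R : RealField) where
  open RealField R hiding (_-_)
  open VectorAlgebra commutativeRing
  open IsTotalOrder ≤-isTotalOrder using (total; antisym; ≤-respˡ-≈; ≤-respʳ-≈) renaming (trans to ≤-trans)
  open import Algebra.Properties.Ring ring using (-‿distribˡ-*; -‿distribʳ-*; -‿involutive)

  x*y≈0⇒y≈0 : ∀ {x y} → x ≉ 0# → x * y ≈ 0# → y ≈ 0#
  x*y≈0⇒y≈0 {x} {y} x≉0 xy≈0 = begin
    y                  ≈⟨ *-identityˡ y ⟨
    1# * y             ≈⟨ *-congʳ (trans (*-comm (x ⁻¹) x) (⁻¹-inverse x x≉0)) ⟨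
    (x ⁻¹ * x) * y     ≈⟨ *-assoc _ _ _ ⟩
    x ⁻¹ * (x * y)     ≈⟨ *-congˡ xy≈0 ⟩
    x ⁻¹ * 0#          ≈⟨ zeroʳ _ ⟩
    0#                 ∎
    where open import Relation.Binary.Reasoning.Setoid setoid

  *-≉0 : ∀ {x y} → x ≉ 0# → y ≉ 0# → x * y ≉ 0#
  *-≉0 x≉0 y≉0 xy≈0 = y≉0 (x*y≈0⇒y≈0 x≉0 xy≈0)

  *-cancelˡ : ∀ {x y z} → x ≉ 0# → x * y ≈ x * z → y ≈ z
  *-cancelˡ {x} {y} {z} x≉0 xy≈xz = x∙y⁻¹≈ε⇒x≈y y z (x*y≈0⇒y≈0 x≉0 (begin
    x * (y - z)          ≈⟨ distribˡ x y (- z) ⟩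
    x * y + x * - z      ≈⟨ +-congˡ (-‿distribʳ-* x z) ⟨
    x * y - x * z        ≈⟨ x≈y⇒x∙y⁻¹≈ε xy≈xz ⟩
    0#                   ∎))
    where
    open import Algebra.Properties.Group +-group using (x∙y⁻¹≈ε⇒x≈y; x≈y⇒x∙y⁻¹≈ε)
    open import Relation.Binary.Reasoning.Setoid setoid

  x*x≥0 : ∀ x → 0# ≤ x * x
  x*x≥0 x with total 0# x
  ... | inj₁ 0≤x = *-nonneg 0≤x 0≤x
  ... | inj₂ x≤0 = ≤-respʳ-≈ -x*-x≈x*x (*-nonneg 0≤-x 0≤-x)
    where
    0≤-x : 0# ≤ - x
    0≤-x = ≤-respˡ-≈ (-‿inverseʳ x) (≤-respʳ-≈ (+-identityˡ (- x)) (+-mono-≤ (- x) x≤0))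
    -x*-x≈x*x : - x * - x ≈ x * x
    -x*-x≈x*x = trans (sym (-‿distribˡ-* x (- x))) (trans (-‿cong (sym (-‿distribʳ-* x x))) (-‿involutive _))

  x≤x+y : ∀ {x y} → 0# ≤ y → x ≤ x + y
  x≤x+y {x} {y} 0≤y = ≤-respˡ-≈ (+-identityˡ x) (≤-respʳ-≈ (+-comm y x) (+-mono-≤ x 0≤y))

  +-nonneg : ∀ {x y} → 0# ≤ x → 0# ≤ y → 0# ≤ x + y
  +-nonneg 0≤x 0≤y = ≤-trans 0≤x (x≤x+y 0≤y)

  +-nonneg-≈0 : ∀ {x y} → 0# ≤ x → 0# ≤ y → x + y ≈ 0# → x ≈ 0# × y ≈ 0#
  +-nonneg-≈0 0≤x 0≤y x+y≈0 =
    antisym (≤-respʳ-≈ x+y≈0 (x≤x+y 0≤y)) 0≤x ,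
    antisym (≤-respʳ-≈ (trans (+-comm _ _) x+y≈0) (x≤x+y 0≤x)) 0≤y

  2≉0 : 1# + 1# ≉ 0#
  2≉0 2≈0 = 0≉1 (sym (proj₁ (+-nonneg-≈0 0≤1 0≤1 2≈0)))
    where
    0≤1 : 0# ≤ 1#
    0≤1 = ≤-respʳ-≈ (*-identityˡ 1#) (x*x≥0 1#)

  x+x≈0⇒x≈0 : ∀ {x} → x + x ≈ 0# → x ≈ 0#
  x+x≈0⇒x≈0 {x} x+x≈0 = x*y≈0⇒y≈0 2≉0 (trans (trans (distribʳ x 1# 1#) (+-cong (*-identityˡ x) (*-identityˡ x))) x+x≈0)

  half≉0 : half ≉ 0#
  half≉0 half≈0 = 0≉1 (trans (sym (y≈0⇒x*y≈0 (1# + 1#) half≈0)) (⁻¹-inverse _ 2≉0))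

  half-sqrt-injective : ∀ {x y} → 0# ≤ x → 0# ≤ y → half * sqrt x ≈ half * sqrt y → x ≈ y
  half-sqrt-injective {x} {y} 0≤x 0≤y eq = begin
    x                    ≈⟨ sqrt-sq x 0≤x ⟨
    sqrt x * sqrt x      ≈⟨ *-cong √x≈√y √x≈√y ⟩
    sqrt y * sqrt y      ≈⟨ sqrt-sq y 0≤y ⟩
    y                    ∎
    where
    √x≈√y : sqrt x ≈ sqrt y
    √x≈√y = *-cancelˡ half≉0 eq
    open import Relation.Binary.Reasoning.Setoid setoid

  infix 4 _≉ᵛ_
  _≉ᵛ_ : Vector³ → Vector³ → Set
  u ≉ᵛ w = ¬ u ≈ᵛ w

  ∣∣²-nonneg : ∀ u → 0# ≤ ∣ u ∣²
  ∣∣²-nonneg (u₁ , u₂ , u₃) = +-nonneg (x*x≥0 u₁) (+-nonneg (x*x≥0 u₂) (x*x≥0 u₃))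

  ∣∣²-≉0 : ∀ {u} → u ≉ᵛ 0ᵛ → ∣ u ∣² ≉ 0#
  ∣∣²-≉0 {u₁ , u₂ , u₃} u≉0 ∣u∣²≈0 =
    square≉0 u₁²≈0 λ u₁≈0 → square≉0 u₂²≈0 λ u₂≈0 → square≉0 u₃²≈0 λ u₃≈0 → u≉0 (u₁≈0 , u₂≈0 , u₃≈0)
    where
    square≉0 : ∀ {x} → x * x ≈ 0# → ¬ x ≉ 0#
    square≉0 x²≈0 x≉0 = *-≉0 x≉0 x≉0 x²≈0
    u₁²≈0 : u₁ * u₁ ≈ 0#
    u₁²≈0 = proj₁ (+-nonneg-≈0 (x*x≥0 u₁) (+-nonneg (x*x≥0 u₂) (x*x≥0 u₃)) ∣u∣²≈0)
    u₂²+u₃²≈0 : u₂ * u₂ + u₃ * u₃ ≈ 0#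
    u₂²+u₃²≈0 = proj₂ (+-nonneg-≈0 (x*x≥0 u₁) (+-nonneg (x*x≥0 u₂) (x*x≥0 u₃)) ∣u∣²≈0)
    u₂²≈0 : u₂ * u₂ ≈ 0#
    u₂²≈0 = proj₁ (+-nonneg-≈0 (x*x≥0 u₂) (x*x≥0 u₃) u₂²+u₃²≈0)
    u₃²≈0 : u₃ * u₃ ≈ 0#
    u₃²≈0 = proj₂ (+-nonneg-≈0 (x*x≥0 u₂) (x*x≥0 u₃) u₂²+u₃²≈0)

  *ᵛ-≈0ᵛ : ∀ {s u} → s ≉ 0# → s *ᵛ u ≈ᵛ 0ᵛ → u ≈ᵛ 0ᵛ
  *ᵛ-≈0ᵛ s≉0 (p₁ , p₂ , p₃) = x*y≈0⇒y≈0 s≉0 p₁ , x*y≈0⇒y≈0 s≉0 p₂ , x*y≈0⇒y≈0 s≉0 p₃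

  parallel-trans : ∀ {n u w} → n ≉ᵛ 0ᵛ → n ⨯ u ≈ᵛ 0ᵛ → n ⨯ w ≈ᵛ 0ᵛ → u ⨯ w ≈ᵛ 0ᵛ
  parallel-trans {n} {u} {w} n≉0 n∥u n∥w = *ᵛ-≈0ᵛ (*-≉0 S≉0 S≉0) (begin
    (S * S) *ᵛ (u ⨯ w)                      ≈⟨ *ᵛ-⨯-*ᵛ S S u w ⟨
    (S *ᵛ u) ⨯ (S *ᵛ w)                     ≈⟨ ⨯-cong (parallel-projection n∥u) (parallel-projection n∥w) ⟩
    ((u · n) *ᵛ n) ⨯ ((w · n) *ᵛ n)         ≈⟨ *ᵛ-⨯-*ᵛ (u · n) (w · n) n n ⟩
    ((u · n) * (w · n)) *ᵛ (n ⨯ n)          ≈⟨ *ᵛ-zeroʳ _ (⨯-self n) ⟩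
    0ᵛ                                       ∎)
    where
    S : Carrier
    S = ∣ n ∣²
    S≉0 : S ≉ 0#
    S≉0 = ∣∣²-≉0 n≉0
    open import Relation.Binary.Reasoning.Setoid vectorSetoid

¬¬-all₃ : ∀ {p} {P : Fin 3 → Set p} → (∀ i → ¬ ¬ P i) → ¬ ¬ (∀ i → P i)
¬¬-all₃ {P = P} ¬¬P ¬∀P = ¬¬P zero λ p₀ → ¬¬P (suc zero) λ p₁ → ¬¬P (suc (suc zero)) λ p₂ → ¬∀P (all p₀ p₁ p₂)
  where
  all : P zero → P (suc zero) → P (suc (suc zero)) → ∀ i → P i
  all p₀ p₁ p₂ zero = p₀
  all p₀ p₁ p₂ (suc zero) = p₁
  all p₀ p₁ p₂ (suc (suc zero)) = p₂

pigeonhole₃ : ∀ {p q} {P : Fin 3 → Set p} {Q : Fin 3 → Set q} → (∀ i → P i ⊎ Q i) →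
  (∃₂ λ i j → i ≢ j × P i × P j) ⊎ (∃₂ λ i j → i ≢ j × Q i × Q j)
pigeonhole₃ h with h zero | h (suc zero) | h (suc (suc zero))
... | inj₁ p₀ | inj₁ p₁ | _       = inj₁ (_ , _ , (λ ()) , p₀ , p₁)
... | inj₁ p₀ | inj₂ _  | inj₁ p₂ = inj₁ (_ , _ , (λ ()) , p₀ , p₂)
... | inj₁ _  | inj₂ q₁ | inj₂ q₂ = inj₂ (_ , _ , (λ ()) , q₁ , q₂)
... | inj₂ q₀ | inj₂ q₁ | _       = inj₂ (_ , _ , (λ ()) , q₀ , q₁)
... | inj₂ q₀ | inj₁ _  | inj₂ q₂ = inj₂ (_ , _ , (λ ()) , q₀ , q₂)
... | inj₂ _  | inj₁ p₁ | inj₁ p₂ = inj₁ (_ , _ , (λ ()) , p₁ , p₂)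

module PlaneConfigurations (R : RealField) where
  open RealField R hiding (_-_)
  open VectorAlgebra commutativeRing
  open RealFieldProperties R
  open import Algebra.Properties.Group +-group using (x≈y⇒x∙y⁻¹≈ε)

  ∧-annihilator : ∀ {v v′ w} → v ∧ v′ ≉ 0# → v ∧ w ≈ 0# → v′ ∧ w ≈ 0# → w ≈² 0²
  ∧-annihilator {v@(v₁ , v₂)} {v′@(v₁′ , v₂′)} {w} v∦v′ vw≈0 v′w≈0
    with ∧-resolve v v′ w
  ... | p₁ , p₂ =
    x*y≈0⇒y≈0 v∦v′ (trans p₁ (x-y≈0 (x≈0⇒x*y≈0 v₁′ vw≈0) (x≈0⇒x*y≈0 v₁ v′w≈0))) ,
    x*y≈0⇒y≈0 v∦v′ (trans p₂ (x-y≈0 (x≈0⇒x*y≈0 v₂′ vw≈0) (x≈0⇒x*y≈0 v₂ v′w≈0)))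

  -- Since (v i ∧ x)² = (v i ∧ y)², each v i annihilates x − y or x + y; two of the three annihilate
  -- the same vector, which therefore vanishes, and then x ∧ y = 0.
  three-directions : ∀ (v : Fin 3 → Vector²) x y →
    (∀ i → (v i ∧ x) * (v i ∧ x) ≈ (v i ∧ y) * (v i ∧ y)) →
    (∀ i j → i ≢ j → v i ∧ v j ≉ 0#) → x ∧ y ≉ 0# → ⊥
  three-directions v x y equal independent x∦y =
    ¬¬-all₃ annihilates-difference-or-sum λ choice → [ via-difference , via-sum ] (pigeonhole₃ choice)
    where
    annihilates-difference-or-sum : ∀ i → ¬ ¬ (v i ∧ (x -² y) ≈ 0# ⊎ v i ∧ (x +² y) ≈ 0#)
    annihilates-difference-or-sum i k = ¬¬-excluded-middle λ where
      (yes p) → k (inj₁ p)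
      (no ¬p) → k (inj₂ (x*y≈0⇒y≈0 ¬p (trans (sym (∧-square-difference (v i) x y)) (x≈y⇒x∙y⁻¹≈ε (equal i)))))
    via-difference : (∃₂ λ i j → i ≢ j × v i ∧ (x -² y) ≈ 0# × v j ∧ (x -² y) ≈ 0#) → ⊥
    via-difference (i , j , i≢j , p , q) =
      x∦y (trans (sym (∧-difference x y)) (∧-zeroˡ y (∧-annihilator (independent i j i≢j) p q)))
    via-sum : (∃₂ λ i j → i ≢ j × v i ∧ (x +² y) ≈ 0# × v j ∧ (x +² y) ≈ 0#) → ⊥
    via-sum (i , j , i≢j , p , q) =
      x∦y (trans (sym (∧-sum x y)) (∧-zeroʳ x (∧-annihilator (independent i j i≢j) p q)))

module SpaceConfigurations (R : RealField) where
  open RealField R hiding (_-_)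
  open VectorAlgebra commutativeRing
  open RealFieldProperties R
  open IntegerCoefficientSolver commutativeRing using (solve; _⊜_)
  open import Algebra.Properties.Group +-group using (x∙y⁻¹≈ε⇒x≈y; x≈y⇒x∙y⁻¹≈ε)
  open import Algebra.Properties.Ring ring using (-‿involutive; -0#≈0#)
  module ≈-Reasoning = Relation.Binary.Reasoning.Setoid setoid
  module ≈ᵛ-Reasoning = Relation.Binary.Reasoning.Setoid vectorSetoid

  -x≈0⇒x≈0 : ∀ {x} → - x ≈ 0# → x ≈ 0#
  -x≈0⇒x≈0 {x} -x≈0 = trans (sym (-‿involutive x)) (trans (-‿cong -x≈0) -0#≈0#)

  vanishes-on-plane : ∀ q {a b c} → c · (a ⨯ b) ≈ 0# → a ⨯ b ≉ᵛ 0ᵛ → c ⨯ b ≉ᵛ 0ᵛ → a ⨯ c ≉ᵛ 0ᵛ →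
    q ⟦ a ⟧ ≈ 0# → q ⟦ b ⟧ ≈ 0# → q ⟦ c ⟧ ≈ 0# → ∀ l m → q ⟦ l *ᵛ a +ᵛ m *ᵛ b ⟧ ≈ 0#
  vanishes-on-plane q {a} {b} {c} coplanar a∦b c∦b a∦c qa≈0 qb≈0 qc≈0 l m = begin
    q ⟦ l *ᵛ a +ᵛ m *ᵛ b ⟧                         ≈⟨ value-pair q l m a b ⟩
    (l * l) * q ⟦ a ⟧ + (m * m) * q ⟦ b ⟧ + (l * m) * B₂ ≈⟨ x+y≈0 (diagonal≈0 l m) (y≈0⇒x*y≈0 (l * m) B₂≈0) ⟩
    0#                                               ∎
    where
    open ≈-Reasoning
    n : Vector³
    n = a ⨯ b
    S : Carrier
    S = ∣ n ∣²
    α : Carrier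
    α = (c ⨯ b) · n
    β : Carrier
    β = (a ⨯ c) · n
    B₂ : Carrier
    B₂ = polar q a b + polar q a b
    S≉0 : S ≉ 0#
    S≉0 = ∣∣²-≉0 a∦b
    diagonal≈0 : ∀ l m → (l * l) * q ⟦ a ⟧ + (m * m) * q ⟦ b ⟧ ≈ 0#
    diagonal≈0 l m = x+y≈0 (y≈0⇒x*y≈0 (l * l) qa≈0) (y≈0⇒x*y≈0 (m * m) qb≈0)
    Sc≈αa+βb : S *ᵛ c ≈ᵛ α *ᵛ a +ᵛ β *ᵛ b
    Sc≈αa+βb = ≈ᵛ-trans (plane-decomposition a b c) (+ᵛ-identityʳ′ _ (*ᵛ-zeroˡ n coplanar))
    α≉0 : α ≉ 0#
    α≉0 α≈0 = c∦b (*ᵛ-≈0ᵛ S≉0 (≈ᵛ-trans (≈ᵛ-sym (*ᵛ-⨯ˡ S c b))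
      (≈ᵛ-trans (⨯-cong Sc≈αa+βb ≈ᵛ-refl) (≈ᵛ-trans (pair-⨯ʳ α β a b) (*ᵛ-zeroˡ n α≈0)))))
    β≉0 : β ≉ 0#
    β≉0 β≈0 = a∦c (*ᵛ-≈0ᵛ S≉0 (≈ᵛ-trans (≈ᵛ-sym (⨯-*ᵛʳ S a c))
      (≈ᵛ-trans (⨯-cong ≈ᵛ-refl Sc≈αa+βb) (≈ᵛ-trans (pair-⨯ˡ α β a b) (*ᵛ-zeroˡ n β≈0)))))
    B₂≈0 : B₂ ≈ 0#
    B₂≈0 = x*y≈0⇒y≈0 (*-≉0 α≉0 β≉0) (begin
      (α * β) * B₂                                        ≈⟨ +-identityˡ _ ⟨
      0# + (α * β) * B₂                                   ≈⟨ +-congʳ (diagonal≈0 α β) ⟨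
      (α * α) * q ⟦ a ⟧ + (β * β) * q ⟦ b ⟧ + (α * β) * B₂ ≈⟨ value-pair q α β a b ⟨
      q ⟦ α *ᵛ a +ᵛ β *ᵛ b ⟧                              ≈⟨ ⟦⟧-cong q Sc≈αa+βb ⟨
      q ⟦ S *ᵛ c ⟧                                         ≈⟨ value-*ᵛ q S c ⟩
      (S * S) * q ⟦ c ⟧                                    ≈⟨ y≈0⇒x*y≈0 (S * S) qc≈0 ⟩
      0#                                                   ∎)

  isotropic-plane⇒∣x∣²≈∣y∣² : ∀ {a b x y} → (∀ l m → areaDifference x y ⟦ l *ᵛ a +ᵛ m *ᵛ b ⟧ ≈ 0#) →
    a ⨯ b ≉ᵛ 0ᵛ → x ⨯ y ≉ᵛ 0ᵛ → ∣ x ∣² ≈ ∣ y ∣²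
  isotropic-plane⇒∣x∣²≈∣y∣² {a} {b} {x} {y} isotropic a∦b x∦y = x∙y⁻¹≈ε⇒x≈y _ _ (x*y≈0⇒y≈0 T≉0 (begin
    T * k                                      ≈⟨ *-comm T k ⟩
    k * T                                      ≈⟨ -x≈0⇒x≈0 (trans (sym (areaDifference-normals n x y)) (x+y≈0 (on-normal x) (on-normal y))) ⟩
    0#                                         ∎))
    where
    open ≈-Reasoning
    n : Vector³
    n = a ⨯ b
    k : Carrier
    k = ∣ x ∣² - ∣ y ∣²
    T : Carrier
    T = ∣ n ⨯ x ∣² + ∣ n ⨯ y ∣²
    on-normal : ∀ w → areaDifference x y ⟦ n ⨯ w ⟧ ≈ 0#
    on-normal w = trans (⟦⟧-cong (areaDifference x y) (bac-cab a b w)) (isotropic _ _)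
    T≉0 : T ≉ 0#
    T≉0 T≈0 with +-nonneg-≈0 (∣∣²-nonneg (n ⨯ x)) (∣∣²-nonneg (n ⨯ y)) T≈0
    ... | nx²≈0 , ny²≈0 = ∣∣²-≉0 (λ n∥x → ∣∣²-≉0 (λ n∥y → x∦y (parallel-trans a∦b n∥x n∥y)) ny²≈0) nx²≈0

  products-vanishing : ∀ {α₁ α₂ β₁ β₂} → α₁ * β₁ ≈ 0# → α₂ * β₂ ≈ 0# → (α₁ + α₂) * (β₁ + β₂) ≈ 0# →
    ¬ ¬ ((α₁ ≈ 0# × α₂ ≈ 0#) ⊎ (β₁ ≈ 0# × β₂ ≈ 0#))
  products-vanishing {α₁} {α₂} {β₁} {β₂} p₁ p₂ p k = ¬¬-excluded-middle λ where
    (no α₁≉0) → ¬¬-excluded-middle λ where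
      (no α₂≉0) → k (inj₂ (x*y≈0⇒y≈0 α₁≉0 p₁ , x*y≈0⇒y≈0 α₂≉0 p₂))
      (yes α₂≈0) → let β₁≈0 = x*y≈0⇒y≈0 α₁≉0 p₁ in
        k (inj₂ (β₁≈0 , x*y≈0⇒y≈0 α₁≉0 (trans (sym (*-cong (y≈0⇒x+y≈x α₂≈0) (x≈0⇒x+y≈y β₁≈0))) p)))
    (yes α₁≈0) → ¬¬-excluded-middle λ where
      (yes α₂≈0) → k (inj₁ (α₁≈0 , α₂≈0))
      (no α₂≉0) → let β₂≈0 = x*y≈0⇒y≈0 α₂≉0 p₂ in
        k (inj₂ (x*y≈0⇒y≈0 α₂≉0 (trans (sym (*-cong (x≈0⇒x+y≈y α₁≈0) (y≈0⇒x+y≈x β₂≈0))) p) , β₂≈0))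

  -- The line through x in direction n meets the sphere of radius ∣ x ∣ again only in the mirror image of x.
  mirror-point : ∀ {n x w} → n ≉ᵛ 0ᵛ → ∣ w ∣² ≈ ∣ x ∣² → n ⨯ (x -ᵛ w) ≈ᵛ 0ᵛ → x -ᵛ w ≉ᵛ 0ᵛ →
    ∣ n ∣² *ᵛ w ≈ᵛ mirror n x
  mirror-point {n} {x} {w} n≉0 ∣w∣≈∣x∣ n∥u u≉0 = begin
    S *ᵛ w                             ≈⟨ *ᵛ-difference S x w ⟩
    S *ᵛ x -ᵛ S *ᵛ u                   ≈⟨ -ᵛ-congˡ (S *ᵛ x) (≈ᵛ-trans Su≈ln (*ᵛ-cong l≈2xn ≈ᵛ-refl)) ⟩
    mirror n x                         ∎
    where
    open ≈ᵛ-Reasoning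
    u : Vector³
    u = x -ᵛ w
    S : Carrier
    S = ∣ n ∣²
    l : Carrier
    l = u · n
    Su≈ln : S *ᵛ u ≈ᵛ l *ᵛ n
    Su≈ln = parallel-projection n∥u
    xn : Carrier
    xn = x · n
    xu : Carrier
    xu = x · u
    S≉0 : S ≉ 0#
    S≉0 = ∣∣²-≉0 n≉0
    l≉0 : l ≉ 0#
    l≉0 l≈0 = u≉0 (*ᵛ-≈0ᵛ S≉0 (≈ᵛ-trans Su≈ln (*ᵛ-zeroˡ n l≈0)))
    ∣u∣²≈2xu : ∣ u ∣² ≈ xu + xu
    ∣u∣²≈2xu = trans (∣-ᵛ∣²-polarisation x w) (y≈0⇒x+y≈x (x≈0⇒-x≈0 (x≈y⇒x∙y⁻¹≈ε (sym ∣w∣≈∣x∣))))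
    Sxu≈lxn : S * xu ≈ l * xn
    Sxu≈lxn = trans (sym (·-*ᵛʳ S x u)) (trans (·-cong ≈ᵛ-refl Su≈ln) (·-*ᵛʳ l x n))
    l≈2xn : l ≈ xn + xn
    l≈2xn = *-cancelˡ l≉0 (*-cancelˡ S≉0 (Scalar.begin
      S * (l * l)                Scalar.≈⟨ *-comm S (l * l) ⟩
      (l * l) * S                Scalar.≈⟨ trans (sym (∣*ᵛ∣² S u)) (trans (·-cong Su≈ln Su≈ln) (∣*ᵛ∣² l n)) ⟨
      (S * S) * ∣ u ∣²           Scalar.≈⟨ *-congˡ ∣u∣²≈2xu ⟩
      (S * S) * (xu + xu)        Scalar.≈⟨ solve 2 (λ S p → (S ⊗ S) ⊗ (p ⊕ p) ⊜ S ⊗ (S ⊗ p ⊕ S ⊗ p)) refl S xu ⟩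
      S * (S * xu + S * xu)      Scalar.≈⟨ *-congˡ (+-cong Sxu≈lxn Sxu≈lxn) ⟩
      S * (l * xn + l * xn)      Scalar.≈⟨ *-congˡ (distribˡ l xn xn) ⟨
      S * (l * (xn + xn))        Scalar.∎))
      where module Scalar = ≈-Reasoning

  coplanar-reflection : ∀ {a b c x y} → c · (a ⨯ b) ≈ 0# → a ⨯ b ≉ᵛ 0ᵛ → c ⨯ b ≉ᵛ 0ᵛ → a ⨯ c ≉ᵛ 0ᵛ →
    areaDifference x y ⟦ a ⟧ ≈ 0# → areaDifference x y ⟦ b ⟧ ≈ 0# → areaDifference x y ⟦ c ⟧ ≈ 0# → x ⨯ y ≉ᵛ 0ᵛ →
    ¬ ¬ (mirror (a ⨯ b) x ⨯ y ≈ᵛ 0ᵛ)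
  coplanar-reflection {a} {b} {c} {x} {y} coplanar a∦b c∦b a∦c qa≈0 qb≈0 qc≈0 x∦y k =
    products-vanishing (factor qa≈0) (factor qb≈0) factor-sum λ where
      (inj₁ (au≈0 , bu≈0)) → k (reflected y (⨯-self y) (sym ∣x∣≈∣y∣) (-ᵛ-⨯ x y) au≈0 bu≈0)
      (inj₂ (au≈0 , bu≈0)) → k (reflected (-ᵛ y) (-ᵛ-⨯-self y) (trans (∣-ᵛ∣² y) (sym ∣x∣≈∣y∣)) (-ᵛ-ᵛ-⨯ x y) au≈0 bu≈0)
    where
    q : QuadraticForm
    q = areaDifference x y
    n : Vector³
    n = a ⨯ b
    plane : ∀ l m → q ⟦ l *ᵛ a +ᵛ m *ᵛ b ⟧ ≈ 0#
    plane = vanishes-on-plane q coplanar a∦b c∦b a∦c qa≈0 qb≈0 qc≈0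
    ∣x∣≈∣y∣ : ∣ x ∣² ≈ ∣ y ∣²
    ∣x∣≈∣y∣ = isotropic-plane⇒∣x∣²≈∣y∣² plane a∦b x∦y
    factor : ∀ {w} → q ⟦ w ⟧ ≈ 0# → (w · (x -ᵛ y)) * (w · (x -ᵛ -ᵛ y)) ≈ 0#
    factor {w} qw≈0 = trans (sym (y≈0⇒x+y≈x (x≈0⇒-x≈0 (x≈0⇒x*y≈0 ∣ w ∣² (x≈y⇒x∙y⁻¹≈ε ∣x∣≈∣y∣)))))
      (trans (sym (areaDifference-factorisation x y w)) qw≈0)
    sum-· : ∀ v → (1# *ᵛ a +ᵛ 1# *ᵛ b) · v ≈ a · v + b · v
    sum-· v = trans (·-pair 1# 1# a b v) (+-cong (*-identityˡ _) (*-identityˡ _))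
    factor-sum : (a · (x -ᵛ y) + b · (x -ᵛ y)) * (a · (x -ᵛ -ᵛ y) + b · (x -ᵛ -ᵛ y)) ≈ 0#
    factor-sum = trans (*-cong (sym (sum-· _)) (sym (sum-· _))) (factor (plane 1# 1#))
    reflected : ∀ w → w ⨯ y ≈ᵛ 0ᵛ → ∣ w ∣² ≈ ∣ x ∣² → (x -ᵛ w) ⨯ y ≈ᵛ x ⨯ y →
      a · (x -ᵛ w) ≈ 0# → b · (x -ᵛ w) ≈ 0# → mirror n x ⨯ y ≈ᵛ 0ᵛ
    reflected w w∥y ∣w∣≈∣x∣ shift au≈0 bu≈0 = begin
      mirror n x ⨯ y       ≈⟨ ⨯-cong (mirror-point a∦b ∣w∣≈∣x∣ n∥u u≉0) ≈ᵛ-refl ⟨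
      (∣ n ∣² *ᵛ w) ⨯ y    ≈⟨ *ᵛ-⨯ˡ ∣ n ∣² w y ⟩
      ∣ n ∣² *ᵛ (w ⨯ y)    ≈⟨ *ᵛ-zeroʳ ∣ n ∣² w∥y ⟩
      0ᵛ                   ∎
      where
      open ≈ᵛ-Reasoning
      n∥u : (a ⨯ b) ⨯ (x -ᵛ w) ≈ᵛ 0ᵛ
      n∥u = ≈ᵛ-trans (bac-cab a b (x -ᵛ w)) (+ᵛ-≈0ᵛ (*ᵛ-zeroˡ a (x≈0⇒-x≈0 bu≈0)) (*ᵛ-zeroˡ b au≈0))
      u≉0 : x -ᵛ w ≉ᵛ 0ᵛ
      u≉0 = λ u≈0 → x∦y (≈ᵛ-trans (≈ᵛ-sym shift) (⨯-zeroˡ y u≈0))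

  -- Both y and z are parallel to the mirror image of x in the plane of a, b and c.
  coplanar-case : ∀ {a b c x y z} → c · (a ⨯ b) ≈ 0# → a ⨯ b ≉ᵛ 0ᵛ → c ⨯ b ≉ᵛ 0ᵛ → a ⨯ c ≉ᵛ 0ᵛ →
    areaDifference x y ⟦ a ⟧ ≈ 0# → areaDifference x y ⟦ b ⟧ ≈ 0# → areaDifference x y ⟦ c ⟧ ≈ 0# →
    areaDifference x z ⟦ a ⟧ ≈ 0# → areaDifference x z ⟦ b ⟧ ≈ 0# → areaDifference x z ⟦ c ⟧ ≈ 0# →
    x ⨯ y ≉ᵛ 0ᵛ → x ⨯ z ≉ᵛ 0ᵛ → y ⨯ z ≉ᵛ 0ᵛ → ⊥
  coplanar-case {a} {b} {c} {x} {y} {z} coplanar a∦b c∦b a∦c qa qb qc ra rb rc x∦y x∦z y∦z =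
    coplanar-reflection coplanar a∦b c∦b a∦c qa qb qc x∦y λ m∥y →
    coplanar-reflection coplanar a∦b c∦b a∦c ra rb rc x∦z λ m∥z →
    y∦z (parallel-trans m≉0 m∥y m∥z)
    where
    S≉0 : ∣ a ⨯ b ∣² ≉ 0#
    S≉0 = ∣∣²-≉0 a∦b
    x≉0 : x ≉ᵛ 0ᵛ
    x≉0 x≈0 = x∦y (⨯-zeroˡ y x≈0)
    m≉0 : mirror (a ⨯ b) x ≉ᵛ 0ᵛ
    m≉0 m≈0 = ∣∣²-≉0 x≉0 (x*y≈0⇒y≈0 (*-≉0 S≉0 S≉0) (trans (sym (∣mirror∣² (a ⨯ b) x)) (·-zeroʳ _ m≈0)))

  GeneralPosition : ∀ {m} → (Fin m → Vector³) → Set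
  GeneralPosition v = ∀ i j k → i ≢ j → j ≢ k → i ≢ k → det (v i , v j , v k) ≉ 0#

  conic-through-columns : ∀ q u v w → q ⟦ u ⟧ ≈ 0# → q ⟦ v ⟧ ≈ 0# → q ⟦ w ⟧ ≈ 0# → ∀ t →
    (det (u , v , w) * det (u , v , w)) * q ⟦ t ⟧ ≈ cremona (cramer (u , v , w) t) · polarVector q (u , v , w)
  conic-through-columns q u v w qu≈0 qv≈0 qw≈0 t = begin
    (D * D) * q ⟦ t ⟧                         ≈⟨ value-*ᵛ q D t ⟨
    q ⟦ D *ᵛ t ⟧                              ≈⟨ ⟦⟧-cong q (cramer-rule M t) ⟩
    q ⟦ M ⟨$⟩ cramer M t ⟧                    ≈⟨ value-⟨$⟩ q u v w _ _ _ ⟩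
    _ + cremona (cramer M t) · polarVector q M
      ≈⟨ x≈0⇒x+y≈y (x+y≈0 (x+y≈0 (y≈0⇒x*y≈0 _ qu≈0) (y≈0⇒x*y≈0 _ qv≈0)) (y≈0⇒x*y≈0 _ qw≈0)) ⟩
    cremona (cramer M t) · polarVector q M    ∎
    where
    open ≈-Reasoning
    M : Matrix
    M = u , v , w
    D : Carrier
    D = det M

  -- Through five points of the projective plane in general position passes only one conic.
  conics-through-five-points : ∀ q q′ (v : Fin 5 → Vector³) → let M = v (# 0) , v (# 1) , v (# 2) in
    det M ≉ 0# → cremona (cramer M (v (# 3))) ⨯ cremona (cramer M (v (# 4))) ≉ᵛ 0ᵛ →
    (∀ i → q ⟦ v i ⟧ ≈ 0#) → (∀ i → q′ ⟦ v i ⟧ ≈ 0#) → ∀ s t → q ⟦ s ⟧ * q′ ⟦ t ⟧ ≈ q′ ⟦ s ⟧ * q ⟦ t ⟧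
  conics-through-five-points q q′ v D≉0 N≉0 qv≈0 q′v≈0 s t = x∙y⁻¹≈ε⇒x≈y _ _ (x*y≈0⇒y≈0 (*-≉0 D²≉0 D²≉0) (begin
    (D² * D²) * (q ⟦ s ⟧ * q′ ⟦ t ⟧ - q′ ⟦ s ⟧ * q ⟦ t ⟧)
      ≈⟨ solve 5 (λ d a b c e → (d ⊗ d) ⊗ (a ⊗ b ⊕ ⊝ (c ⊗ e)) ⊜ (d ⊗ a) ⊗ (d ⊗ b) ⊕ ⊝ ((d ⊗ c) ⊗ (d ⊗ e))) refl D² _ _ _ _ ⟩
    (D² * q ⟦ s ⟧) * (D² * q′ ⟦ t ⟧) - (D² * q′ ⟦ s ⟧) * (D² * q ⟦ t ⟧)
      ≈⟨ +-cong (*-cong (conic s) (conic′ t)) (-‿cong (*-cong (conic′ s) (conic t))) ⟩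
    (G s · b) * (G t · b′) - (G s · b′) * (G t · b)
      ≈⟨ binet-cauchy (G s) (G t) b b′ ⟩
    (G s ⨯ G t) · (b ⨯ b′)
      ≈⟨ ·-zeroʳ (G s ⨯ G t) (parallel-trans N≉0 (normal-parallel conic qv≈0) (normal-parallel conic′ q′v≈0)) ⟩
    0# ∎))
    where
    open ≈-Reasoning
    M : Matrix
    M = v (# 0) , v (# 1) , v (# 2)
    D² : Carrier
    D² = det M * det M
    D²≉0 : D² ≉ 0#
    D²≉0 = *-≉0 D≉0 D≉0
    G : Vector³ → Vector³
    G t = cremona (cramer M t)
    b : Vector³
    b = polarVector q M
    b′ : Vector³
    b′ = polarVector q′ M
    conic : ∀ t → D² * q ⟦ t ⟧ ≈ G t · b
    conic = conic-through-columns q (v (# 0)) (v (# 1)) (v (# 2)) (qv≈0 _) (qv≈0 _) (qv≈0 _)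
    conic′ : ∀ t → D² * q′ ⟦ t ⟧ ≈ G t · b′
    conic′ = conic-through-columns q′ (v (# 0)) (v (# 1)) (v (# 2)) (q′v≈0 _) (q′v≈0 _) (q′v≈0 _)
    normal-parallel : ∀ {r} → (∀ t → D² * r ⟦ t ⟧ ≈ G t · polarVector r M) → (∀ i → r ⟦ v i ⟧ ≈ 0#) →
      (G (v (# 3)) ⨯ G (v (# 4))) ⨯ polarVector r M ≈ᵛ 0ᵛ
    normal-parallel {r} conic-r rv≈0 = ≈ᵛ-trans (bac-cab _ _ _)
      (+ᵛ-≈0ᵛ (*ᵛ-zeroˡ _ (x≈0⇒-x≈0 (on-conic (# 4)))) (*ᵛ-zeroˡ _ (on-conic (# 3))))
      where
      on-conic : ∀ i → G (v i) · polarVector r M ≈ 0#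
      on-conic i = trans (sym (conic-r (v i))) (y≈0⇒x*y≈0 D² (rv≈0 i))

  cremona-⨯-≈0ᵛ : ∀ {c₁ c₂ c₃ k₁ k₂ k₃} → c₁ * k₁ ≉ 0# → c₂ * k₂ ≉ 0# → c₃ * k₃ ≉ 0# →
    cremona (c₁ , c₂ , c₃) ⨯ cremona (k₁ , k₂ , k₃) ≈ᵛ 0ᵛ → (c₁ , c₂ , c₃) ⨯ (k₁ , k₂ , k₃) ≈ᵛ 0ᵛ
  cremona-⨯-≈0ᵛ {c₁} {c₂} {c₃} {k₁} {k₂} {k₃} ck₁≉0 ck₂≉0 ck₃≉0 N≈0 =
    x*y≈0⇒y≈0 ck₁≉0 (proj₂ (proj₂ e)) , x*y≈0⇒y≈0 ck₂≉0 (proj₁ (proj₂ e)) , x*y≈0⇒y≈0 ck₃≉0 (proj₁ e)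
    where
    e : ((c₃ * k₃) * (c₁ * k₂ - c₂ * k₁) , (c₂ * k₂) * (c₃ * k₁ - c₁ * k₃) , (c₁ * k₁) * (c₂ * k₃ - c₃ * k₂)) ≈ᵛ 0ᵛ
    e = ≈ᵛ-trans (≈ᵛ-sym (cremona-⨯ c₁ c₂ c₃ k₁ k₂ k₃)) N≈0

  cramer-⨯-≈0ᵛ : ∀ M a b → det M ≉ 0# → cramer M a ⨯ cramer M b ≈ᵛ 0ᵛ → a ⨯ b ≈ᵛ 0ᵛ
  cramer-⨯-≈0ᵛ M a b D≉0 c∥k = *ᵛ-≈0ᵛ (*-≉0 D≉0 D≉0) (begin
    (D * D) *ᵛ (a ⨯ b)                   ≈⟨ *ᵛ-⨯-*ᵛ D D a b ⟨
    (D *ᵛ a) ⨯ (D *ᵛ b)                  ≈⟨ ⨯-cong (cramer-rule M a) (cramer-rule M b) ⟩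
    (M ⟨$⟩ cramer M a) ⨯ (M ⟨$⟩ cramer M b) ≈⟨ ⟨$⟩-⨯ M (cramer M a) (cramer M b) ⟩
    cofactor M ⟨$⟩ (cramer M a ⨯ cramer M b) ≈⟨ ⟨$⟩-zero (cofactor M) c∥k ⟩
    0ᵛ                                    ∎)
    where
    open ≈ᵛ-Reasoning
    D : Carrier
    D = det M

  cremona-independent : ∀ (v : Fin 5 → Vector³) → GeneralPosition v → v (# 3) ⨯ v (# 4) ≉ᵛ 0ᵛ →
    let M = v (# 0) , v (# 1) , v (# 2) in cremona (cramer M (v (# 3))) ⨯ cremona (cramer M (v (# 4))) ≉ᵛ 0ᵛ
  cremona-independent v general v₃∦v₄ N≈0 = v₃∦v₄ (cramer-⨯-≈0ᵛ M (v (# 3)) (v (# 4)) (general (# 0) (# 1) (# 2) (λ ()) (λ ()) (λ ()))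
    (cremona-⨯-≈0ᵛ (*-≉0 (general (# 3) (# 1) (# 2) (λ ()) (λ ()) (λ ())) (general (# 4) (# 1) (# 2) (λ ()) (λ ()) (λ ())))
                   (*-≉0 (general (# 0) (# 3) (# 2) (λ ()) (λ ()) (λ ())) (general (# 0) (# 4) (# 2) (λ ()) (λ ()) (λ ())))
                   (*-≉0 (general (# 0) (# 1) (# 3) (λ ()) (λ ()) (λ ())) (general (# 0) (# 1) (# 4) (λ ()) (λ ()) (λ ()))) N≈0))
    where
    M : Matrix
    M = v (# 0) , v (# 1) , v (# 2)
  areaDifferences-not-proportional : ∀ {x y z} → x ⨯ y ≉ᵛ 0ᵛ → x ⨯ z ≉ᵛ 0ᵛ → y ⨯ z ≉ᵛ 0ᵛ →
    ¬ (∀ s t → areaDifference x y ⟦ s ⟧ * areaDifference x z ⟦ t ⟧ ≈ areaDifference x z ⟦ s ⟧ * areaDifference x y ⟦ t ⟧)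
  areaDifferences-not-proportional {x} {y} {z} x∦y x∦z y∦z proportional = ∣∣²-≉0 y∦z (x+x≈0⇒x≈0 (begin
    P + P                  ≈⟨ +-cong P≈-A+C P≈-C+A ⟩
    (- A + C) + (- C + A)  ≈⟨ solve 2 (λ A C → (⊝ A ⊕ C) ⊕ (⊝ C ⊕ A) ⊜ (A ⊕ C) ⊕ ⊝ (A ⊕ C)) refl A C ⟩
    (A + C) - (A + C)      ≈⟨ -‿inverseʳ (A + C) ⟩
    0#                     ∎))
    where
    open ≈-Reasoning
    q : QuadraticForm
    q = areaDifference x y
    r : QuadraticForm
    r = areaDifference x z
    A : Carrier
    A = ∣ x ⨯ y ∣²
    C : Carrier
    C = ∣ x ⨯ z ∣²
    P : Carrier
    P = ∣ y ⨯ z ∣²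
    swap : ∀ a c → c * - a ≈ a * - c
    swap = solve 2 (λ a c → c ⊗ ⊝ a ⊜ a ⊗ ⊝ c) refl
    ry≈-C : r ⟦ y ⟧ ≈ - C
    ry≈-C = *-cancelˡ (∣∣²-≉0 x∦y) (begin
      A * r ⟦ y ⟧        ≈⟨ *-congʳ (areaDifference-first x y) ⟨
      q ⟦ x ⟧ * r ⟦ y ⟧  ≈⟨ proportional x y ⟩
      r ⟦ x ⟧ * q ⟦ y ⟧  ≈⟨ *-cong (areaDifference-first x z) (areaDifference-second x y) ⟩
      C * - A            ≈⟨ swap A C ⟩
      A * - C            ∎)
    qz≈-A : q ⟦ z ⟧ ≈ - A
    qz≈-A = *-cancelˡ (∣∣²-≉0 x∦z) (begin
      C * q ⟦ z ⟧        ≈⟨ *-congʳ (areaDifference-first x z) ⟨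
      r ⟦ x ⟧ * q ⟦ z ⟧  ≈⟨ proportional x z ⟨
      q ⟦ x ⟧ * r ⟦ z ⟧  ≈⟨ *-cong (areaDifference-first x y) (areaDifference-second x z) ⟩
      A * - C            ≈⟨ swap A C ⟨
      C * - A            ∎)
    P≈-A+C : P ≈ - A + C
    P≈-A+C = trans (sym (areaDifference-third x y z)) (+-cong qz≈-A (areaDifference-first x z))
    P≈-C+A : P ≈ - C + A
    P≈-C+A = trans (∣⨯∣²-comm y z) (trans (sym (areaDifference-third x z y)) (+-cong ry≈-C (areaDifference-first x y)))

  CoplanarTriple : ∀ {m} → (Fin m → Vector³) → Set
  CoplanarTriple v = ∃ λ i → ∃ λ j → ∃ λ k → i ≢ j × j ≢ k × i ≢ k × det (v i , v j , v k) ≈ 0#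

  five-directions : ∀ (v : Fin 5 → Vector³) x y z →
    (∀ i → areaDifference x y ⟦ v i ⟧ ≈ 0#) → (∀ i → areaDifference x z ⟦ v i ⟧ ≈ 0#) →
    (∀ i j → i ≢ j → v i ⨯ v j ≉ᵛ 0ᵛ) → x ⨯ y ≉ᵛ 0ᵛ → x ⨯ z ≉ᵛ 0ᵛ → y ⨯ z ≉ᵛ 0ᵛ → ⊥
  five-directions v x y z qv≈0 rv≈0 independent x∦y x∦z y∦z = ¬¬-excluded-middle {A = CoplanarTriple v} λ where
    (yes (i , j , k , i≢j , j≢k , i≢k , coplanar)) →
      coplanar-case (trans (sym (det-cyclic _ _ _)) coplanar)
        (independent i j i≢j) (independent k j (≢-sym j≢k)) (independent i k i≢k)
        (qv≈0 i) (qv≈0 j) (qv≈0 k) (rv≈0 i) (rv≈0 j) (rv≈0 k) x∦y x∦z y∦z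
    (no ¬coplanar) →
      let general : GeneralPosition v
          general i j k i≢j j≢k i≢k d≈0 = ¬coplanar (i , j , k , i≢j , j≢k , i≢k , d≈0)
      in areaDifferences-not-proportional x∦y x∦z y∦z (conics-through-five-points _ _ v
           (general (# 0) (# 1) (# 2) (λ ()) (λ ()) (λ ()))
           (cremona-independent v general (independent (# 3) (# 4) (λ ()))) qv≈0 rv≈0)

module AreaColourings (R : RealField) where
  open RealField R hiding (_-_; zero)
  open Geometry R
  open VectorAlgebra commutativeRing
  open RealFieldProperties R
  open IntegerCoefficientSolver commutativeRing using (solve; _⊜_; expressions)
  private module E {n} = Coordinates (expressions n)
  open import Algebra.Properties.Group +-group using (x≈y⇒x∙y⁻¹≈ε)

  det2² : Point2 → Point2 → Point2 → Carrier
  det2² p q r = det2 p q r * det2 p q r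

  det2²-swap₁₂ : ∀ p q r → det2² p q r ≈ det2² q p r
  det2²-swap₁₂ (p₁ , p₂) (q₁ , q₂) (r₁ , r₂) =
    solve 6 (λ p₁ p₂ q₁ q₂ r₁ r₂ → let p = p₁ , p₂ ; q = q₁ , q₂ ; r = r₁ , r₂ in
      ((q E.-² p) E.∧ (r E.-² p)) ⊗ ((q E.-² p) E.∧ (r E.-² p)) ⊜ ((p E.-² q) E.∧ (r E.-² q)) ⊗ ((p E.-² q) E.∧ (r E.-² q)))
      refl p₁ p₂ q₁ q₂ r₁ r₂

  det2²-swap₂₃ : ∀ p q r → det2² p q r ≈ det2² p r q
  det2²-swap₂₃ (p₁ , p₂) (q₁ , q₂) (r₁ , r₂) =
    solve 6 (λ p₁ p₂ q₁ q₂ r₁ r₂ → let p = p₁ , p₂ ; q = q₁ , q₂ ; r = r₁ , r₂ in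
      ((q E.-² p) E.∧ (r E.-² p)) ⊗ ((q E.-² p) E.∧ (r E.-² p)) ⊜ ((r E.-² p) E.∧ (q E.-² p)) ⊗ ((r E.-² p) E.∧ (q E.-² p)))
      refl p₁ p₂ q₁ q₂ r₁ r₂

  cross3²-swap₁₂ : ∀ p q r → normSq3 (cross3 p q r) ≈ normSq3 (cross3 q p r)
  cross3²-swap₁₂ (p₁ , p₂ , p₃) (q₁ , q₂ , q₃) (r₁ , r₂ , r₃) =
    solve 9 (λ p₁ p₂ p₃ q₁ q₂ q₃ r₁ r₂ r₃ → let p = p₁ , p₂ , p₃ ; q = q₁ , q₂ , q₃ ; r = r₁ , r₂ , r₃ in
      E.∣ (q E.-ᵛ p) E.⨯ (r E.-ᵛ p) ∣² ⊜ E.∣ (p E.-ᵛ q) E.⨯ (r E.-ᵛ q) ∣²) refl p₁ p₂ p₃ q₁ q₂ q₃ r₁ r₂ r₃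

  cross3²-swap₂₃ : ∀ p q r → normSq3 (cross3 p q r) ≈ normSq3 (cross3 p r q)
  cross3²-swap₂₃ (p₁ , p₂ , p₃) (q₁ , q₂ , q₃) (r₁ , r₂ , r₃) =
    solve 9 (λ p₁ p₂ p₃ q₁ q₂ q₃ r₁ r₂ r₃ → let p = p₁ , p₂ , p₃ ; q = q₁ , q₂ , q₃ ; r = r₁ , r₂ , r₃ in
      E.∣ (q E.-ᵛ p) E.⨯ (r E.-ᵛ p) ∣² ⊜ E.∣ (r E.-ᵛ p) E.⨯ (q E.-ᵛ p) ∣²) refl p₁ p₂ p₃ q₁ q₂ q₃ r₁ r₂ r₃

  AREA2-injective : ∀ {p q r p′ q′ r′} → AREA2 p q r ≈ AREA2 p′ q′ r′ → det2² p q r ≈ det2² p′ q′ r′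
  AREA2-injective = half-sqrt-injective (x*x≥0 _) (x*x≥0 _)

  AREA3-injective : ∀ {p q r p′ q′ r′} → AREA3 p q r ≈ AREA3 p′ q′ r′ → normSq3 (cross3 p q r) ≈ normSq3 (cross3 p′ q′ r′)
  AREA3-injective = half-sqrt-injective (∣∣²-nonneg _) (∣∣²-nonneg _)

  plane-theorem : (n : ℕ) (p : Fin n → Point2) → Distinct2 p → NoThreeCollinear2 p →
    (V : Subset n) → ∣ V ∣ ≡ 6 → ¬ Whomog _≈_ (λ i j k → AREA2 (p i) (p j) (p k)) V
  plane-theorem n p _ noncollinear V ∣V∣≡6 (I , proper , H) =
    three-directions (λ k → p (spoke k) -² p centre) (p (tip zero) -² p centre) (p (tip (suc zero)) -² p centre)
      (λ k → equicoloured k zero (suc zero))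
      (λ k l k≢l → noncollinear centre (spoke k) (spoke l) (centre≢spoke k) (spoke-injective k≢l) (centre≢spoke l))
      (noncollinear centre (tip zero) (tip (suc zero)) (centre≢tip zero) (tip-injective λ ()) (centre≢tip (suc zero)))
    where
    open PlaneConfigurations R
    open Pencil (pencil setoid (λ i j k → det2²-swap₁₂ (p i) (p j) (p k)) (λ i j k → det2²-swap₂₃ (p i) (p j) (p k))
      (I , proper , IWhomog-map _≈_ _≈_ AREA2-injective H) 2 3 (subst (5 ℕ.<_) (≡.sym ∣V∣≡6) ℕ.≤-refl))

  space-theorem : (n : ℕ) (p : Fin n → Point3) → Distinct3 p → NoThreeCollinear3 p →
    (V : Subset n) → ∣ V ∣ ≡ 13 → ¬ Whomog _≈_ (λ i j k → AREA3 (p i) (p j) (p k)) V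
  space-theorem n p _ noncollinear V ∣V∣≡13 (I , proper , H) =
    five-directions (λ k → p (spoke k) -ᵛ p centre) (x zero) (x (suc zero)) (x (suc (suc zero)))
      (λ k → on-areaDifference k (suc zero)) (λ k → on-areaDifference k (suc (suc zero)))
      (λ k l k≢l → noncollinear centre (spoke k) (spoke l) (centre≢spoke k) (spoke-injective k≢l) (centre≢spoke l))
      (tips-independent zero (suc zero) (λ ())) (tips-independent zero (suc (suc zero)) (λ ()))
      (tips-independent (suc zero) (suc (suc zero)) (λ ()))
    where
    open SpaceConfigurations R
    open Pencil (pencil setoid (λ i j k → cross3²-swap₁₂ (p i) (p j) (p k)) (λ i j k → cross3²-swap₂₃ (p i) (p j) (p k))
      (I , proper , IWhomog-map _≈_ _≈_ AREA3-injective H) 3 5 (subst (8 ℕ.<_) (≡.sym ∣V∣≡13) (ℕ.m≤m+n 9 4)))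
    x : Fin 3 → Vector³
    x i = p (tip i) -ᵛ p centre
    on-areaDifference : ∀ k i → areaDifference (x zero) (x i) ⟦ p (spoke k) -ᵛ p centre ⟧ ≈ 0#
    on-areaDifference k i = trans (areaDifference-value _ _ _) (x≈y⇒x∙y⁻¹≈ε (equicoloured k i zero))
    tips-independent : ∀ i j → i ≢ j → x i ⨯ x j ≉ᵛ 0ᵛ
    tips-independent i j i≢j = noncollinear centre (tip i) (tip j) (centre≢tip i) (tip-injective i≢j) (centre≢tip j)


mainTheorem10 : (R : RealField) →
    let open RealField R using (_≈_) in
    let open Geometry R in
    ((n : ℕ) (p : Fin n → Point2) → Distinct2 p → NoThreeCollinear2 p →
      (V : Subset n) → ∣ V ∣ ≡ 6 →
      ¬ Whomog _≈_ (λ i j k → AREA2 (p i) (p j) (p k)) V)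
    ×
    ((n : ℕ) (p : Fin n → Point3) → Distinct3 p → NoThreeCollinear3 p →
      (V : Subset n) → ∣ V ∣ ≡ 13 →
      ¬ Whomog _≈_ (λ i j k → AREA3 (p i) (p j) (p k)) V)
mainTheorem10 R = plane-theorem , space-theorem
  where open AreaColourings R
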